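{- Let $t\ge2$, let $\kappa$ be a $t$-core with $n$-vector $(n_0,n_1,\dots,n_{t-1})$, and let $a\in\{0,1\}$. If $t\equiv 1+2a\pmod 4$, then \[ \mathrm{srank}(\kappa)\equiv\sum_{i=0}^{t-1}\bigl(n_i+(1-2a)i+a\bigr)^3\pmod 4; \] and if $t\equiv 2a\pmod 4$, then \[ \mathrm{srank}(\kappa)\equiv\sum_{i=0}^{t-1}\bigl(a\,n_i^2+(i^2+i)n_i\bigr)\pmod 4. \]
   Context: A partition is a $t$-core if it has no rim hook (hook) of length $t$. For a partition $\pi$ with conjugate $\pi'$, $\mathcal{O}(\pi)$ is the number of odd parts and $\mathrm{srank}(\pi)=\mathcal{O}(\pi)-\mathcal{O}(\pi')$. The $n$-vector of a $t$-core $\kappa$ is $(r_0-r_1,r_1-r_2,\dots,r_{t-2}-r_{t-1},r_{t-1}-r_0)$, where $r_i$ is the number of cells $(a,b)$ (row $a$, column $b$) of the Young diagram of $\kappa$ with $b-a\equiv i\pmod t$. -}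

module Defs where

open import Data.Nat as ℕ using (ℕ; zero; suc; _≤_; _≤?_; _⊔_; NonZero)
open import Data.Nat.DivMod using (_%_)
open import Data.Integer as ℤ using (ℤ; +_; _-_)
open import Data.Integer.DivMod using (_%ℕ_)
open import Data.List using (List; []; _∷_; map; upTo; length; filter; foldr; _++_; concatMap)
open import Data.List.Relation.Unary.All using (All)
open import Data.List.Relation.Unary.Any using (Any)
open import Data.Product using (_×_; _,_)
open import Relation.Binary.PropositionalEquality using (_≡_)
open import Relation.Nullary using (¬_)

data Decreasing : List ℕ → Set where
  []  : Decreasing []
  [_] : ∀ x → Decreasing (x ∷ [])
  _∷_ : ∀ {x y xs} → y ≤ x → Decreasing (y ∷ xs) → Decreasing (x ∷ y ∷ xs)

IsPartition : List ℕ → Set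
IsPartition λs = Decreasing λs × All (λ x → 1 ≤ x) λs

-- i-th part, 1-indexed rows; 0 beyond the length
part : List ℕ → ℕ → ℕ
part []       _             = 0
part (x ∷ xs) zero          = 0
part (x ∷ xs) (suc zero)    = x
part (x ∷ xs) (suc (suc i)) = part xs (suc i)

conjugate : List ℕ → List ℕ
conjugate λs = map (λ j → length (filter (j ≤?_) λs)) (map suc (upTo (foldr _⊔_ 0 λs)))

-- cells (a , b) of the Young diagram: row a, column b, both 1-indexed
cellsFrom : ℕ → List ℕ → List (ℕ × ℕ)
cellsFrom r []       = []
cellsFrom r (x ∷ xs) = map (λ b → (r , b)) (map suc (upTo x)) ++ cellsFrom (suc r) xs

cells : List ℕ → List (ℕ × ℕ)
cells = cellsFrom 1

hookLength : List ℕ → ℕ × ℕ → ℕ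
hookLength λs (a , b) = suc ((part λs a ℕ.∸ b) ℕ.+ (part (conjugate λs) b ℕ.∸ a))

-- t-core: no cell has hook length t (equivalently no rim hook of length t)
IsCore : ℕ → List ℕ → Set
IsCore t λs = ¬ Any (λ c → hookLength λs c ≡ t) (cells λs)

oddParts : List ℕ → ℕ
oddParts λs = length (filter (λ x → x % 2 ℕ.≟ 1) λs)

srank : List ℕ → ℤ
srank λs = + oddParts λs - + oddParts (conjugate λs)

residueCount : (t : ℕ) → .{{NonZero t}} → List ℕ → ℕ → ℕ
residueCount t λs i =
  length (filter (λ c → ((+ (Data.Product.proj₂ c)) - (+ (Data.Product.proj₁ c))) %ℕ t ℕ.≟ i) (cells λs))

nvec : (t : ℕ) → .{{NonZero t}} → List ℕ → ℕ → ℤ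
nvec t λs i = + residueCount t λs i - + residueCount t λs (suc i % t)

sumTo : ℕ → (ℕ → ℤ) → ℤ
sumTo t f = foldr ℤ._+_ (+ 0) (map f (upTo t))

-- Encode κ, with L rows, by its β-numbers κ_j − j together with all positions below −L, and
-- place them on a t-runner abacus. Since κ is a t-core, y − t is a bead whenever y is (a gap
-- y − t ≥ −L below a bead y ends a hook of length t), so runner r is filled from −∞ up to
-- r + t·c_r, and counting contents shows that the runner charges c_r are the entries n_r of the
-- n-vector. Adding the beads from the bottom one at a time raises a single charge c_r = m to
-- m + 1, which changes Σ_r f(c_r, r) by f(m+1, r) − f(m, r) ≡ w(r + t·m) (mod 4), where
-- w(y) = y(y+1) + δ, for both summands f of the theorem under its hypothesis on t mod 4. Hence
-- Σ_r f(n_r, r) ≡ Σ_r f(0, r) + Σ_j (w(κ_j − j) − w(−j)), and Σ_r f(0, r) ≡ 0. Row by row,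
-- srank κ = Σ_j (odd(κ_j) − (−1)^(j−1) κ_j), and each term is ≡ w(κ_j − j) − w(−j) (mod 4).

module Submission where

open import Defs
open import Data.Nat using (ℕ; _≤_; NonZero)
open import Data.Nat.DivMod using (_%_)
open import Data.Integer using (ℤ; +_; _+_; _-_; _*_)
open import Data.Integer.Divisibility using (_∣_)
open import Data.List using (List)
open import Data.Product using (_×_)
open import Relation.Binary.PropositionalEquality using (_≡_)

open import Data.Empty using (⊥-elim)
open import Data.Integer as ℤ using (-[1+_]; +[1+_]; -_; _⊖_; 0ℤ; 1ℤ)
open import Data.Integer.DivMod using (_%ℕ_; _/ℕ_; n%ℕd<d; a≡a%ℕn+[a/ℕn]*n)
import Data.Integer.Properties as ℤ
open import Data.Integer.Tactic.RingSolver using (solve-∀)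
open import Data.List using ([]; _∷_; _++_; length; filter; map; upTo; applyUpTo; foldr)
open import Data.List.Membership.DecPropositional ℤ._≟_ using (_∈?_)
open import Data.List.Membership.Propositional using (_∈_; _∉_; lose)
open import Data.List.Membership.Propositional.Properties using (∈-++⁺ˡ; ∈-++⁺ʳ; ∈-map⁺; ∈-upTo⁺)
import Data.List.Properties as List
open import Data.List.Relation.Unary.All as All using (All; []; _∷_)
open import Data.List.Relation.Unary.Any using (Any; here; there)
open import Data.Nat as ℕ using (zero; suc; _<_)
import Data.Nat.Divisibility as ℕ
open import Data.Nat.DivMod using (_/_; m≡m%n+[m/n]*n; m<n⇒m%n≡m; [m+n]%n≡m%n)
import Data.Nat.Properties as ℕ
open import Data.Product using (_,_; proj₁; proj₂; ∃-syntax)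
open import Data.Sum using (_⊎_; inj₁; inj₂)
open import Function using (_∘_)
open import Relation.Binary using (tri<; tri≈; tri>)
open import Relation.Binary.PropositionalEquality
  using (_≢_; refl; subst; subst₂; sym; trans; cong; cong₂; module ≡-Reasoning)
open import Relation.Nullary using (Dec; yes; no; _×-dec_; _→-dec_)
open import Relation.Nullary.Decidable using (map′; from-yes)
open import Relation.Unary using (Decidable)

-- Arithmetic modulo 4

data ℤ₄ : Set where
  0₄ 1₄ 2₄ 3₄ : ℤ₄

suc₄ : ℤ₄ → ℤ₄
suc₄ 0₄ = 1₄
suc₄ 1₄ = 2₄
suc₄ 2₄ = 3₄
suc₄ 3₄ = 0₄

fromℕ₄ : ℕ → ℤ₄
fromℕ₄ zero    = 0₄
fromℕ₄ (suc n) = suc₄ (fromℕ₄ n)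

toℕ₄ : ℤ₄ → ℕ
toℕ₄ 0₄ = 0
toℕ₄ 1₄ = 1
toℕ₄ 2₄ = 2
toℕ₄ 3₄ = 3

fromℕ₄∘toℕ₄ : ∀ a → fromℕ₄ (toℕ₄ a) ≡ a
fromℕ₄∘toℕ₄ 0₄ = refl
fromℕ₄∘toℕ₄ 1₄ = refl
fromℕ₄∘toℕ₄ 2₄ = refl
fromℕ₄∘toℕ₄ 3₄ = refl

infix 4 _≟₄_
_≟₄_ : (a b : ℤ₄) → Dec (a ≡ b)
a ≟₄ b = map′ (λ e → trans (sym (fromℕ₄∘toℕ₄ a)) (trans (cong fromℕ₄ e) (fromℕ₄∘toℕ₄ b)))
              (cong toℕ₄) (toℕ₄ a ℕ.≟ toℕ₄ b)

∀₄? : {P : ℤ₄ → Set} → (∀ a → Dec (P a)) → Dec (∀ a → P a)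
∀₄? P? = map′ (λ { (p₀ , p₁ , p₂ , p₃) → λ { 0₄ → p₀ ; 1₄ → p₁ ; 2₄ → p₂ ; 3₄ → p₃ } })
              (λ p → p 0₄ , p 1₄ , p 2₄ , p 3₄)
              (P? 0₄ ×-dec P? 1₄ ×-dec P? 2₄ ×-dec P? 3₄)

infixl 6 _+₄_ _-₄_
infixl 7 _*₄_
infix  8 -₄_

_+₄_ : ℤ₄ → ℤ₄ → ℤ₄
0₄ +₄ b = b
1₄ +₄ b = suc₄ b
2₄ +₄ b = suc₄ (suc₄ b)
3₄ +₄ b = suc₄ (suc₄ (suc₄ b))

-₄_ : ℤ₄ → ℤ₄
-₄ 0₄ = 0₄
-₄ 1₄ = 3₄
-₄ 2₄ = 2₄
-₄ 3₄ = 1₄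

_-₄_ : ℤ₄ → ℤ₄ → ℤ₄
a -₄ b = a +₄ -₄ b

_*₄_ : ℤ₄ → ℤ₄ → ℤ₄
0₄ *₄ b = 0₄
1₄ *₄ b = b
2₄ *₄ b = b +₄ b
3₄ *₄ b = b +₄ b +₄ b

suc₄-+₄ : ∀ a b → suc₄ (a +₄ b) ≡ suc₄ a +₄ b
suc₄-+₄ = from-yes (∀₄? λ a → ∀₄? λ b → suc₄ (a +₄ b) ≟₄ suc₄ a +₄ b)

suc₄-*₄ : ∀ a b → b +₄ a *₄ b ≡ suc₄ a *₄ b
suc₄-*₄ = from-yes (∀₄? λ a → ∀₄? λ b → b +₄ a *₄ b ≟₄ suc₄ a *₄ b)

-₄-cancel-suc₄ : ∀ a b → suc₄ a -₄ suc₄ b ≡ a -₄ b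
-₄-cancel-suc₄ = from-yes (∀₄? λ a → ∀₄? λ b → suc₄ a -₄ suc₄ b ≟₄ a -₄ b)

+₄-comm : ∀ a b → a +₄ b ≡ b +₄ a
+₄-comm = from-yes (∀₄? λ a → ∀₄? λ b → a +₄ b ≟₄ b +₄ a)

+₄-cancelˡ : ∀ a b → b ≡ a +₄ b -₄ a
+₄-cancelˡ = from-yes (∀₄? λ a → ∀₄? λ b → b ≟₄ a +₄ b -₄ a)

-₄-inverseʳ : ∀ a → a -₄ a ≡ 0₄
-₄-inverseʳ = from-yes (∀₄? λ a → a -₄ a ≟₄ 0₄)

-₄-involutive : ∀ a → -₄ -₄ a ≡ a
-₄-involutive = from-yes (∀₄? λ a → -₄ -₄ a ≟₄ a)

-₄-distribˡ-*₄ : ∀ a b → -₄ (a *₄ b) ≡ -₄ a *₄ b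
-₄-distribˡ-*₄ = from-yes (∀₄? λ a → ∀₄? λ b → -₄ (a *₄ b) ≟₄ -₄ a *₄ b)

-₄-distribʳ-*₄ : ∀ a b → -₄ (a *₄ b) ≡ a *₄ -₄ b
-₄-distribʳ-*₄ = from-yes (∀₄? λ a → ∀₄? λ b → -₄ (a *₄ b) ≟₄ a *₄ -₄ b)

fromℕ₄-+ : ∀ m n → fromℕ₄ (m ℕ.+ n) ≡ fromℕ₄ m +₄ fromℕ₄ n
fromℕ₄-+ zero    n = refl
fromℕ₄-+ (suc m) n = trans (cong suc₄ (fromℕ₄-+ m n)) (suc₄-+₄ (fromℕ₄ m) (fromℕ₄ n))

fromℕ₄-* : ∀ m n → fromℕ₄ (m ℕ.* n) ≡ fromℕ₄ m *₄ fromℕ₄ n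
fromℕ₄-* zero    n = refl
fromℕ₄-* (suc m) n = begin
  fromℕ₄ (n ℕ.+ m ℕ.* n)                ≡⟨ fromℕ₄-+ n (m ℕ.* n) ⟩
  fromℕ₄ n +₄ fromℕ₄ (m ℕ.* n)          ≡⟨ cong (fromℕ₄ n +₄_) (fromℕ₄-* m n) ⟩
  fromℕ₄ n +₄ fromℕ₄ m *₄ fromℕ₄ n      ≡⟨ suc₄-*₄ (fromℕ₄ m) (fromℕ₄ n) ⟩
  fromℕ₄ (suc m) *₄ fromℕ₄ n            ∎
  where open ≡-Reasoning

fromℕ₄-%4 : ∀ n → fromℕ₄ n ≡ fromℕ₄ (n % 4)
fromℕ₄-%4 n = begin
  fromℕ₄ n                                    ≡⟨ cong fromℕ₄ (m≡m%n+[m/n]*n n 4) ⟩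
  fromℕ₄ (n % 4 ℕ.+ n / 4 ℕ.* 4)              ≡⟨ fromℕ₄-+ (n % 4) (n / 4 ℕ.* 4) ⟩
  fromℕ₄ (n % 4) +₄ fromℕ₄ (n / 4 ℕ.* 4)      ≡⟨ cong (fromℕ₄ (n % 4) +₄_) (fromℕ₄-* (n / 4) 4) ⟩
  fromℕ₄ (n % 4) +₄ fromℕ₄ (n / 4) *₄ 0₄      ≡⟨ cong (fromℕ₄ (n % 4) +₄_) (*₄-zeroʳ (fromℕ₄ (n / 4))) ⟩
  fromℕ₄ (n % 4) +₄ 0₄                        ≡⟨ +₄-comm (fromℕ₄ (n % 4)) 0₄ ⟩
  fromℕ₄ (n % 4)                              ∎
  where
  open ≡-Reasoning
  *₄-zeroʳ : ∀ a → a *₄ 0₄ ≡ 0₄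
  *₄-zeroʳ = from-yes (∀₄? λ a → a *₄ 0₄ ≟₄ 0₄)

fromℕ₄-cong : ∀ m n → m % 4 ≡ n % 4 → fromℕ₄ m ≡ fromℕ₄ n
fromℕ₄-cong m n eq = trans (fromℕ₄-%4 m) (trans (cong fromℕ₄ eq) (sym (fromℕ₄-%4 n)))

fromℕ₄≡0⇒4∣ : ∀ n → fromℕ₄ n ≡ 0₄ → 4 ℕ.∣ n
fromℕ₄≡0⇒4∣ 0                         _ = ℕ.divides 0 refl
fromℕ₄≡0⇒4∣ (suc (suc (suc (suc n)))) e = ℕ.∣m∣n⇒∣m+n ℕ.∣-refl (fromℕ₄≡0⇒4∣ n (trans (suc₄⁴ (fromℕ₄ n)) e))
  where
  suc₄⁴ : ∀ a → a ≡ suc₄ (suc₄ (suc₄ (suc₄ a)))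
  suc₄⁴ = from-yes (∀₄? λ a → a ≟₄ suc₄ (suc₄ (suc₄ (suc₄ a))))

mod₄ : ℤ → ℤ₄
mod₄ (+ n)    = fromℕ₄ n
mod₄ -[1+ n ] = -₄ fromℕ₄ (suc n)

mod₄-⊖ : ∀ m n → mod₄ (m ⊖ n) ≡ fromℕ₄ m -₄ fromℕ₄ n
mod₄-⊖ m       zero    = sym (+₄-comm (fromℕ₄ m) 0₄)
mod₄-⊖ zero    (suc n) = refl
mod₄-⊖ (suc m) (suc n) = trans (cong mod₄ (ℤ.[1+m]⊖[1+n]≡m⊖n m n))
                               (trans (mod₄-⊖ m n) (sym (-₄-cancel-suc₄ (fromℕ₄ m) (fromℕ₄ n))))

mod₄-+ : ∀ x y → mod₄ (x + y) ≡ mod₄ x +₄ mod₄ y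
mod₄-+ (+ m)    (+ n)    = fromℕ₄-+ m n
mod₄-+ (+ m)    -[1+ n ] = mod₄-⊖ m (suc n)
mod₄-+ -[1+ m ] (+ n)    = trans (mod₄-⊖ n (suc m)) (+₄-comm (fromℕ₄ n) _)
mod₄-+ -[1+ m ] -[1+ n ] = trans (cong (λ a → -₄ suc₄ (suc₄ a)) (fromℕ₄-+ m n)) (neg-suc-+ (fromℕ₄ m) (fromℕ₄ n))
  where
  neg-suc-+ : ∀ a b → -₄ suc₄ (suc₄ (a +₄ b)) ≡ -₄ suc₄ a +₄ -₄ suc₄ b
  neg-suc-+ = from-yes (∀₄? λ a → ∀₄? λ b → -₄ suc₄ (suc₄ (a +₄ b)) ≟₄ -₄ suc₄ a +₄ -₄ suc₄ b)

mod₄-neg : ∀ x → mod₄ (- x) ≡ -₄ mod₄ x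
mod₄-neg (+ zero)  = refl
mod₄-neg (+ suc n) = refl
mod₄-neg -[1+ n ]  = sym (-₄-involutive (fromℕ₄ (suc n)))

mod₄-- : ∀ x y → mod₄ (x - y) ≡ mod₄ x -₄ mod₄ y
mod₄-- x y = trans (mod₄-+ x (- y)) (cong (mod₄ x +₄_) (mod₄-neg y))

mod₄-* : ∀ x y → mod₄ (x * y) ≡ mod₄ x *₄ mod₄ y
mod₄-* (+ m)    y = pos-* m y
  where
  pos-* : ∀ m y → mod₄ (+ m * y) ≡ fromℕ₄ m *₄ mod₄ y
  pos-* m (+ n)    = trans (cong mod₄ (sym (ℤ.pos-* m n))) (fromℕ₄-* m n)
  pos-* m -[1+ n ] = begin
    mod₄ (+ m * -[1+ n ])              ≡⟨ cong mod₄ (sym (ℤ.neg-distribʳ-* (+ m) (+ suc n))) ⟩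
    mod₄ (- (+ m * + suc n))           ≡⟨ mod₄-neg (+ m * + suc n) ⟩
    -₄ mod₄ (+ m * + suc n)            ≡⟨ cong -₄_ (pos-* m (+ suc n)) ⟩
    -₄ (fromℕ₄ m *₄ fromℕ₄ (suc n))    ≡⟨ -₄-distribʳ-*₄ (fromℕ₄ m) (fromℕ₄ (suc n)) ⟩
    fromℕ₄ m *₄ mod₄ -[1+ n ]          ∎
    where open ≡-Reasoning
mod₄-* -[1+ m ] y = begin
  mod₄ (-[1+ m ] * y)                  ≡⟨ cong mod₄ (sym (ℤ.neg-distribˡ-* (+ suc m) y)) ⟩
  mod₄ (- (+ suc m * y))               ≡⟨ mod₄-neg (+ suc m * y) ⟩
  -₄ mod₄ (+ suc m * y)                ≡⟨ cong -₄_ (mod₄-* (+ suc m) y) ⟩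
  -₄ (fromℕ₄ (suc m) *₄ mod₄ y)        ≡⟨ -₄-distribˡ-*₄ (fromℕ₄ (suc m)) (mod₄ y) ⟩
  mod₄ -[1+ m ] *₄ mod₄ y              ∎
  where open ≡-Reasoning

infix 4 _≡₄_
_≡₄_ : ℤ → ℤ → Set
x ≡₄ y = mod₄ x ≡ mod₄ y

≡₄⇒4∣- : ∀ x y → x ≡₄ y → + 4 ∣ x - y
≡₄⇒4∣- x y eq = 4∣ (x - y) (trans (mod₄-- x y) (trans (cong (_-₄ mod₄ y) eq) (-₄-inverseʳ (mod₄ y))))
  where
  -₄≡0₄⇒≡0₄ : ∀ a → -₄ a ≡ 0₄ → a ≡ 0₄
  -₄≡0₄⇒≡0₄ = from-yes (∀₄? λ a → (-₄ a ≟₄ 0₄) →-dec (a ≟₄ 0₄))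
  4∣ : ∀ z → mod₄ z ≡ 0₄ → + 4 ∣ z
  4∣ (+ n)    e = fromℕ₄≡0⇒4∣ n e
  4∣ -[1+ n ] e = fromℕ₄≡0⇒4∣ (suc n) (-₄≡0₄⇒≡0₄ (fromℕ₄ (suc n)) e)

+-cong₄ : ∀ x x′ y y′ → x ≡₄ x′ → y ≡₄ y′ → x + y ≡₄ x′ + y′
+-cong₄ x x′ y y′ eq eq′ = trans (mod₄-+ x y) (trans (cong₂ _+₄_ eq eq′) (sym (mod₄-+ x′ y′)))

+4*≡₄ : ∀ x y → x + + 4 * y ≡₄ x
+4*≡₄ x y = trans (mod₄-+ x (+ 4 * y)) (trans (cong (mod₄ x +₄_) (mod₄-* (+ 4) y)) (+₄-comm (mod₄ x) 0₄))

x+y≡₄z⇒x≡₄z-y : ∀ x y z → x + y ≡₄ z → x ≡₄ z - y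
x+y≡₄z⇒x≡₄z-y x y z eq = begin
  mod₄ x                          ≡⟨ cong mod₄ (cancel x y) ⟩
  mod₄ (x + y - y)                ≡⟨ mod₄-- (x + y) y ⟩
  mod₄ (x + y) -₄ mod₄ y          ≡⟨ cong (_-₄ mod₄ y) eq ⟩
  mod₄ z -₄ mod₄ y                ≡⟨ mod₄-- z y ⟨
  mod₄ (z - y)                    ∎
  where
  open ≡-Reasoning
  cancel : ∀ a b → a ≡ a + b - b
  cancel = solve-∀

pronic : ℤ → ℤ
pronic y = y * (y + 1ℤ)

pronic₄ : ℤ₄ → ℤ₄
pronic₄ a = a *₄ (a +₄ 1₄)

mod₄-pronic : ∀ y → mod₄ (pronic y) ≡ pronic₄ (mod₄ y)
mod₄-pronic y = trans (mod₄-* y (y + 1ℤ)) (cong (mod₄ y *₄_) (mod₄-+ y 1ℤ))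

-- Finite sums and counting

∑ : ℕ → (ℕ → ℤ) → ℤ
∑ zero    h = 0ℤ
∑ (suc n) h = h 0 + ∑ n (h ∘ suc)

sumTo≡∑ : ∀ n h → sumTo n h ≡ ∑ n h
sumTo≡∑ n h = trans (cong (foldr _+_ 0ℤ) (List.map-upTo h n)) (foldr-applyUpTo h n)
  where
  foldr-applyUpTo : ∀ h n → foldr _+_ 0ℤ (applyUpTo h n) ≡ ∑ n h
  foldr-applyUpTo h zero    = refl
  foldr-applyUpTo h (suc n) = cong (_+_ (h 0)) (foldr-applyUpTo (h ∘ suc) n)

∑-cong : ∀ n {h h′ : ℕ → ℤ} → (∀ i → i < n → h i ≡ h′ i) → ∑ n h ≡ ∑ n h′
∑-cong zero    eq = refl
∑-cong (suc n) eq = cong₂ _+_ (eq 0 (ℕ.s≤s ℕ.z≤n)) (∑-cong n (λ i i<n → eq (suc i) (ℕ.s≤s i<n)))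

∑-update : ∀ n (h h′ : ℕ → ℤ) i₀ → i₀ < n → (∀ j → j ≢ i₀ → h′ j ≡ h j) →
           ∑ n h′ ≡ ∑ n h + (h′ i₀ - h i₀)
∑-update (suc n) h h′ zero _ eq = begin
  h′ 0 + ∑ n (h′ ∘ suc)                 ≡⟨ cong (_+_ (h′ 0)) (∑-cong n (λ j _ → eq (suc j) λ ())) ⟩
  h′ 0 + ∑ n (h ∘ suc)                  ≡⟨ rearrange (h′ 0) (h 0) (∑ n (h ∘ suc)) ⟩
  h 0 + ∑ n (h ∘ suc) + (h′ 0 - h 0)    ∎
  where
  open ≡-Reasoning
  rearrange : ∀ a b s → a + s ≡ b + s + (a - b)
  rearrange = solve-∀
∑-update (suc n) h h′ (suc i₀) (ℕ.s≤s i₀<n) eq = begin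
  h′ 0 + ∑ n (h′ ∘ suc)
    ≡⟨ cong₂ _+_ (eq 0 λ ()) (∑-update n (h ∘ suc) (h′ ∘ suc) i₀ i₀<n (λ j j≢i₀ → eq (suc j) (j≢i₀ ∘ ℕ.suc-injective))) ⟩
  h 0 + (∑ n (h ∘ suc) + (h′ (suc i₀) - h (suc i₀)))      ≡⟨ ℤ.+-assoc (h 0) _ _ ⟨
  h 0 + ∑ n (h ∘ suc) + (h′ (suc i₀) - h (suc i₀))        ∎
  where open ≡-Reasoning

∑-distrib-‿- : ∀ n (h h′ : ℕ → ℤ) → ∑ n (λ k → h k - h′ k) ≡ ∑ n h - ∑ n h′
∑-distrib-‿- zero    h h′ = refl
∑-distrib-‿- (suc n) h h′ = trans (cong (_+_ (h 0 - h′ 0)) (∑-distrib-‿- n (h ∘ suc) (h′ ∘ suc)))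
                                 (interchange (h 0) (h′ 0) (∑ n (h ∘ suc)) (∑ n (h′ ∘ suc)))
  where
  interchange : ∀ a b c d → a - b + (c - d) ≡ a + c - (b + d)
  interchange = solve-∀

∑-telescope : ∀ n (G : ℕ → ℤ) → ∑ n (λ k → G (suc k) - G k) ≡ G n - G 0
∑-telescope zero    G = sym (ℤ.+-inverseʳ (G 0))
∑-telescope (suc n) G = trans (cong (_+_ (G 1 - G 0)) (∑-telescope n (G ∘ suc)))
                             (cancel (G 0) (G 1) (G (suc n)))
  where
  cancel : ∀ a b c → b - a + (c - b) ≡ c - a
  cancel = solve-∀

∑-ones : ∀ n → ∑ n (λ _ → 1ℤ) ≡ + n
∑-ones zero    = refl
∑-ones (suc n) = cong (_+_ 1ℤ) (∑-ones n)

∑-extend : ∀ {m n} {h : ℕ → ℤ} → m ≤ n → (∀ k → m ≤ k → h k ≡ 0ℤ) → ∑ n h ≡ ∑ m h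
∑-extend {n = zero}  ℕ.z≤n       h≡0 = refl
∑-extend {n = suc n} ℕ.z≤n       h≡0 = cong₂ _+_ (h≡0 0 ℕ.z≤n) (∑-extend {n = n} ℕ.z≤n (λ k _ → h≡0 (suc k) ℕ.z≤n))
∑-extend {h = h}     (ℕ.s≤s m≤n) h≡0 = cong (_+_ (h 0)) (∑-extend m≤n (λ k m≤k → h≡0 (suc k) (ℕ.s≤s m≤k)))

∑-telescope₄ : ∀ n (h : ℕ → ℤ) (G : ℕ → ℤ₄) → (∀ k → mod₄ (h k) ≡ G (suc k) -₄ G k) →
               mod₄ (∑ n h) ≡ G n -₄ G 0
∑-telescope₄ zero    h G eq = sym (-₄-inverseʳ (G 0))
∑-telescope₄ (suc n) h G eq = begin
  mod₄ (h 0 + ∑ n (h ∘ suc))                    ≡⟨ mod₄-+ (h 0) (∑ n (h ∘ suc)) ⟩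
  mod₄ (h 0) +₄ mod₄ (∑ n (h ∘ suc))            ≡⟨ cong₂ _+₄_ (eq 0) (∑-telescope₄ n (h ∘ suc) (G ∘ suc) (eq ∘ suc)) ⟩
  (G 1 -₄ G 0) +₄ (G (suc n) -₄ G 1)            ≡⟨ cancel (G 0) (G 1) (G (suc n)) ⟩
  G (suc n) -₄ G 0                              ∎
  where
  open ≡-Reasoning
  cancel : ∀ a b c → (b -₄ a) +₄ (c -₄ b) ≡ c -₄ a
  cancel = from-yes (∀₄? λ a → ∀₄? λ b → ∀₄? λ c → (b -₄ a) +₄ (c -₄ b) ≟₄ c -₄ a)

partialSum₄ : (ℤ₄ → ℤ₄) → ℤ₄ → ℤ₄
partialSum₄ φ 0₄ = 0₄
partialSum₄ φ 1₄ = φ 0₄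
partialSum₄ φ 2₄ = φ 0₄ +₄ φ 1₄
partialSum₄ φ 3₄ = φ 0₄ +₄ φ 1₄ +₄ φ 2₄

partialSum₄-telescopes : ∀ φ → φ 0₄ +₄ φ 1₄ +₄ φ 2₄ +₄ φ 3₄ ≡ 0₄ →
                         ∀ I → φ I ≡ partialSum₄ φ (suc₄ I) -₄ partialSum₄ φ I
partialSum₄-telescopes φ _      0₄ = -₄-identityʳ (φ 0₄)
  where
  -₄-identityʳ : ∀ a → a ≡ a -₄ 0₄
  -₄-identityʳ = from-yes (∀₄? λ a → a ≟₄ a -₄ 0₄)
partialSum₄-telescopes φ _      1₄ = +₄-cancelˡ (φ 0₄) (φ 1₄)
partialSum₄-telescopes φ _      2₄ = +₄-cancelˡ (φ 0₄ +₄ φ 1₄) (φ 2₄)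
partialSum₄-telescopes φ period 3₄ = complement (φ 0₄ +₄ φ 1₄ +₄ φ 2₄) (φ 3₄) period
  where
  complement : ∀ a b → a +₄ b ≡ 0₄ → b ≡ 0₄ -₄ a
  complement = from-yes (∀₄? λ a → ∀₄? λ b → (a +₄ b ≟₄ 0₄) →-dec (b ≟₄ 0₄ -₄ a))

∑-periodic₄ : ∀ n (h : ℕ → ℤ) (φ : ℤ₄ → ℤ₄) → (∀ i → mod₄ (h i) ≡ φ (fromℕ₄ i)) →
              φ 0₄ +₄ φ 1₄ +₄ φ 2₄ +₄ φ 3₄ ≡ 0₄ → mod₄ (∑ n h) ≡ partialSum₄ φ (fromℕ₄ n)
∑-periodic₄ n h φ mod₄-h period =
  trans (∑-telescope₄ n h (partialSum₄ φ ∘ fromℕ₄) (λ i → trans (mod₄-h i) (partialSum₄-telescopes φ period (fromℕ₄ i))))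
        (-₄-identityʳ (partialSum₄ φ (fromℕ₄ n)))
  where
  -₄-identityʳ : ∀ a → a -₄ 0₄ ≡ a
  -₄-identityʳ = from-yes (∀₄? λ a → a -₄ 0₄ ≟₄ a)

𝟙 : {P : Set} → Dec P → ℤ
𝟙 (yes _) = 1ℤ
𝟙 (no _)  = 0ℤ

𝟙-cong : ∀ {P Q : Set} → (P → Q) → (Q → P) → (p : Dec P) (q : Dec Q) → 𝟙 p ≡ 𝟙 q
𝟙-cong P→Q Q→P (yes p) (yes q) = refl
𝟙-cong P→Q Q→P (yes p) (no ¬q) = ⊥-elim (¬q (P→Q p))
𝟙-cong P→Q Q→P (no ¬p) (yes q) = ⊥-elim (¬p (Q→P q))
𝟙-cong P→Q Q→P (no ¬p) (no ¬q) = refl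

length-filter-∷ : ∀ {A : Set} {P : A → Set} (P? : Decidable P) x xs →
                  + length (filter P? (x ∷ xs)) ≡ 𝟙 (P? x) + + length (filter P? xs)
length-filter-∷ P? x xs with P? x
... | yes _ = refl
... | no _  = refl

length-filter-++ : ∀ {A : Set} {P : A → Set} (P? : Decidable P) xs ys →
                   + length (filter P? (xs ++ ys)) ≡ + length (filter P? xs) + + length (filter P? ys)
length-filter-++ P? xs ys =
  trans (cong (λ l → + length l) (List.filter-++ P? xs ys))
        (trans (cong +_ (List.length-++ (filter P? xs))) (ℤ.pos-+ (length (filter P? xs)) (length (filter P? ys))))

length-filter-applyUpTo : ∀ {A : Set} {P : A → Set} (P? : Decidable P) (f : ℕ → A) n →
                          + length (filter P? (applyUpTo f n)) ≡ ∑ n (λ k → 𝟙 (P? (f k)))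
length-filter-applyUpTo P? f zero    = refl
length-filter-applyUpTo P? f (suc n) =
  trans (length-filter-∷ P? (f 0) (applyUpTo (f ∘ suc) n))
        (cong (_+_ (𝟙 (P? (f 0)))) (length-filter-applyUpTo P? (f ∘ suc) n))

sumOver : (ℤ → ℤ) → List ℤ → ℤ
sumOver q []       = 0ℤ
sumOver q (y ∷ ys) = q y + sumOver q ys

-- Partitions and conjugates

Decreasing-tail : ∀ {x xs} → Decreasing (x ∷ xs) → Decreasing xs
Decreasing-tail [ x ] = []
Decreasing-tail (_ ∷ d) = d

Decreasing⇒≤head : ∀ {x xs} → Decreasing (x ∷ xs) → All (_≤ x) xs
Decreasing⇒≤head [ x ] = []
Decreasing⇒≤head (y≤x ∷ d) = y≤x ∷ All.map (λ z≤y → ℕ.≤-trans z≤y y≤x) (Decreasing⇒≤head d)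

Decreasing-++⁻ʳ : ∀ pre {xs} → Decreasing (pre ++ xs) → Decreasing xs
Decreasing-++⁻ʳ []        d = d
Decreasing-++⁻ʳ (p ∷ pre) d = Decreasing-++⁻ʳ pre (Decreasing-tail d)

Decreasing-++⇒≥ : ∀ pre {x xs} → Decreasing (pre ++ x ∷ xs) → All (x ≤_) pre
Decreasing-++⇒≥ []        d = []
Decreasing-++⇒≥ (p ∷ pre) d =
  All.lookup (Decreasing⇒≤head d) (∈-++⁺ʳ pre (here refl)) ∷ Decreasing-++⇒≥ pre (Decreasing-tail d)

countAtLeast : ℕ → List ℕ → ℕ
countAtLeast j λs = length (filter (j ℕ.≤?_) λs)

countAtLeast-≥ : ∀ {j xs} → All (j ≤_) xs → countAtLeast j xs ≡ length xs
countAtLeast-≥ j≤xs = cong length (List.filter-all (_ ℕ.≤?_) j≤xs)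

countAtLeast-< : ∀ {j xs} → All (_< j) xs → countAtLeast j xs ≡ 0
countAtLeast-< xs<j = cong length (List.filter-none (_ ℕ.≤?_) (All.map ℕ.<⇒≱ xs<j))

countAtLeast-∷ : ∀ {j x} xs → j ≤ x → countAtLeast j (x ∷ xs) ≡ suc (countAtLeast j xs)
countAtLeast-∷ xs j≤x = cong length (List.filter-accept (_ ℕ.≤?_) j≤x)

maxPart : List ℕ → ℕ
maxPart = foldr ℕ._⊔_ 0

≤-maxPart : ∀ {x xs} → x ∈ xs → x ≤ maxPart xs
≤-maxPart (here refl)  = ℕ.m≤m⊔n _ _
≤-maxPart {xs = y ∷ _} (there x∈xs) = ℕ.≤-trans (≤-maxPart x∈xs) (ℕ.m≤n⊔m y _)

maxPart-≤ : ∀ {x xs} → All (_≤ x) xs → maxPart xs ≤ x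
maxPart-≤ []             = ℕ.z≤n
maxPart-≤ (y≤x ∷ ys≤x) = ℕ.⊔-lub y≤x (maxPart-≤ ys≤x)

part-++ : ∀ pre x xs → part (pre ++ x ∷ xs) (suc (length pre)) ≡ x
part-++ []              x xs = refl
part-++ (p ∷ [])        x xs = refl
part-++ (p ∷ p′ ∷ pre)  x xs = part-++ (p′ ∷ pre) x xs

part-applyUpTo : ∀ (f : ℕ → ℕ) n j → j < n → part (applyUpTo f n) (suc j) ≡ f j
part-applyUpTo f (suc n)       zero    _           = refl
part-applyUpTo f (suc (suc n)) (suc j) (ℕ.s≤s j<n) = part-applyUpTo (f ∘ suc) (suc n) j j<n

conjugate≡applyUpTo : ∀ κ → conjugate κ ≡ applyUpTo (λ k → countAtLeast (suc k) κ) (maxPart κ)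
conjugate≡applyUpTo κ = trans (cong (map (λ j → countAtLeast j κ)) (List.map-upTo suc (maxPart κ)))
                              (List.map-applyUpTo suc (λ j → countAtLeast j κ) (maxPart κ))

part-conjugate : ∀ κ b → 1 ≤ b → b ≤ maxPart κ → part (conjugate κ) b ≡ countAtLeast b κ
part-conjugate κ (suc b) _ b<max =
  trans (cong (λ l → part l (suc b)) (conjugate≡applyUpTo κ))
        (part-applyUpTo (λ k → countAtLeast (suc k) κ) (maxPart κ) b b<max)

cell∈cellsFrom : ∀ r pre x xs b → 1 ≤ b → b ≤ x → (r ℕ.+ length pre , b) ∈ cellsFrom r (pre ++ x ∷ xs)
cell∈cellsFrom r [] x xs (suc b) _ b<x =
  subst (λ a → (a , suc b) ∈ cellsFrom r (x ∷ xs)) (sym (ℕ.+-identityʳ r))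
        (∈-++⁺ˡ (∈-map⁺ (λ c → (r , c)) (∈-map⁺ suc (∈-upTo⁺ b<x))))
cell∈cellsFrom r (p ∷ pre) x xs b 1≤b b≤x =
  subst (λ a → (a , b) ∈ cellsFrom r (p ∷ pre ++ x ∷ xs)) (sym (ℕ.+-suc r (length pre)))
        (∈-++⁺ʳ _ (cell∈cellsFrom (suc r) pre x xs b 1≤b b≤x))

odd : ℕ → ℤ
odd n = 𝟙 (n % 2 ℕ.≟ 1)

%2-suc-suc : ∀ n → suc (suc n) % 2 ≡ n % 2
%2-suc-suc n = trans (cong (_% 2) (ℕ.+-comm 2 n)) ([m+n]%n≡m%n n 2)

odd-suc : ∀ n → odd (suc n) ≡ 1ℤ - odd n
odd-suc zero          = refl
odd-suc (suc zero)    = refl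
odd-suc (suc (suc n)) = trans (cong (λ r → 𝟙 (r ℕ.≟ 1)) (%2-suc-suc (suc n)))
                              (trans (odd-suc n) (cong (λ r → 1ℤ - 𝟙 (r ℕ.≟ 1)) (sym (%2-suc-suc n))))

mod₄-odd : ∀ n → mod₄ (odd n) ≡ fromℕ₄ n *₄ fromℕ₄ n
mod₄-odd zero          = refl
mod₄-odd (suc zero)    = refl
mod₄-odd (suc (suc n)) = trans (cong (λ r → mod₄ (𝟙 (r ℕ.≟ 1))) (%2-suc-suc n))
                               (trans (mod₄-odd n) (square (fromℕ₄ n)))
  where
  square : ∀ a → a *₄ a ≡ suc₄ (suc₄ a) *₄ suc₄ (suc₄ a)
  square = from-yes (∀₄? λ a → a *₄ a ≟₄ suc₄ (suc₄ a) *₄ suc₄ (suc₄ a))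

oddParts-∷ : ∀ x xs → + oddParts (x ∷ xs) ≡ odd x + + oddParts xs
oddParts-∷ x xs = length-filter-∷ (λ n → n % 2 ℕ.≟ 1) x xs

oddParts-conjugate : ∀ κ → + oddParts (conjugate κ) ≡ ∑ (maxPart κ) (λ k → odd (countAtLeast (suc k) κ))
oddParts-conjugate κ =
  trans (cong (λ l → + length (filter (λ n → n % 2 ℕ.≟ 1) l)) (conjugate≡applyUpTo κ))
        (length-filter-applyUpTo _ (λ k → countAtLeast (suc k) κ) (maxPart κ))

oddParts-conjugate-∷ : ∀ x xs → Decreasing (x ∷ xs) →
                       + oddParts (conjugate (x ∷ xs)) ≡ + x - + oddParts (conjugate xs)
oddParts-conjugate-∷ x xs d = begin
  + oddParts (conjugate (x ∷ xs))   ≡⟨ oddParts-conjugate (x ∷ xs) ⟩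
  ∑ (x ℕ.⊔ maxPart xs) (odd ∘ c′)   ≡⟨ cong (λ m → ∑ m (odd ∘ c′)) (ℕ.m≥n⇒m⊔n≡m max≤x) ⟩
  ∑ x (odd ∘ c′)                    ≡⟨ ∑-cong x (λ k k<x → trans (cong odd (countAtLeast-∷ xs k<x)) (odd-suc (c k))) ⟩
  ∑ x (λ k → 1ℤ - odd (c k))        ≡⟨ ∑-distrib-‿- x (λ _ → 1ℤ) (odd ∘ c) ⟩
  ∑ x (λ _ → 1ℤ) - ∑ x (odd ∘ c)    ≡⟨ cong₂ _-_ (∑-ones x) (∑-extend max≤x vanish) ⟩
  + x - ∑ (maxPart xs) (odd ∘ c)    ≡⟨ cong (_-_ (+ x)) (oddParts-conjugate xs) ⟨
  + x - + oddParts (conjugate xs)   ∎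
  where
  open ≡-Reasoning
  c c′ : ℕ → ℕ
  c  k = countAtLeast (suc k) xs
  c′ k = countAtLeast (suc k) (x ∷ xs)
  max≤x : maxPart xs ≤ x
  max≤x = maxPart-≤ (Decreasing⇒≤head d)
  vanish : ∀ k → maxPart xs ≤ k → odd (c k) ≡ 0ℤ
  vanish k max≤k = cong odd (countAtLeast-< {xs = xs} (All.tabulate (λ y∈xs → ℕ.s≤s (ℕ.≤-trans (≤-maxPart y∈xs) max≤k))))

-- β-numbers

-- rowBeads s xs lists the β-numbers κ_j − j of the rows j = s+1, s+2, … holding xs, and
-- seaFrom s L lists −(s+1), …, −(s+L), the β-numbers of L empty rows.
rowBeads : ℕ → List ℕ → List ℤ
rowBeads s []       = []
rowBeads s (x ∷ xs) = + x - + suc s ∷ rowBeads (suc s) xs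

seaFrom : ℕ → ℕ → List ℤ
seaFrom s zero    = []
seaFrom s (suc L) = -[1+ s ] ∷ seaFrom (suc s) L

sumOver-seaFrom-suc : ∀ q s L → sumOver q (seaFrom s (suc L)) ≡ sumOver q (seaFrom s L) + q -[1+ s ℕ.+ L ]
sumOver-seaFrom-suc q s zero    =
  trans (cong (λ k → q -[1+ k ] + 0ℤ) (sym (ℕ.+-identityʳ s))) (ℤ.+-comm (q -[1+ s ℕ.+ 0 ]) 0ℤ)
sumOver-seaFrom-suc q s (suc L) = begin
  q -[1+ s ] + sumOver q (seaFrom (suc s) (suc L))                   ≡⟨ cong (_+_ (q -[1+ s ])) (sumOver-seaFrom-suc q (suc s) L) ⟩
  q -[1+ s ] + (sumOver q (seaFrom (suc s) L) + q -[1+ suc s ℕ.+ L ]) ≡⟨ ℤ.+-assoc (q -[1+ s ]) _ _ ⟨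
  q -[1+ s ] + sumOver q (seaFrom (suc s) L) + q -[1+ suc s ℕ.+ L ]   ≡⟨ cong (λ k → S + q -[1+ k ]) (ℕ.+-suc s L) ⟨
  q -[1+ s ] + sumOver q (seaFrom (suc s) L) + q -[1+ s ℕ.+ suc L ]   ∎
  where
  open ≡-Reasoning
  S = q -[1+ s ] + sumOver q (seaFrom (suc s) L)

-[1+n]<-n : ∀ n → -[1+ n ] ℤ.< - + n
-[1+n]<-n n = ℤ.suc[i]≤j⇒i<j (ℤ.≤-reflexive (ℤ.1-[1+n]≡-n n))

rowBeads-below : ∀ {x} s r xs → s < r → All (_≤ x) xs → All (ℤ._< + x - + suc s) (rowBeads r xs)
rowBeads-below s r []       s<r []           = []
rowBeads-below s r (y ∷ ys) s<r (y≤x ∷ ys≤x) =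
  ℤ.+-mono-≤-< (ℤ.+≤+ y≤x) (ℤ.neg-mono-< (ℤ.+<+ (ℕ.s≤s s<r))) ∷ rowBeads-below s (suc r) ys (ℕ.m<n⇒m<1+n s<r) ys≤x

gap-column-base : ∀ {x r w} zs → - + r ℤ.≤ w → w ℤ.< + x - + r →
                  (∀ {b} → + b ≡ w + 1ℤ + + r → All (_< b) zs) →
                  ∃[ b ] (1 ≤ b × b ≤ x × + b ≡ w + 1ℤ + + r + + countAtLeast b zs)
gap-column-base {x} {r} {w} zs -r≤w w<x-r zs<b = b , 1≤b , b≤x , +b≡
  where
  v = w + 1ℤ + + r
  1≤v : 1ℤ ℤ.≤ v
  1≤v = subst₂ ℤ._≤_ (cancel (+ r)) (sym (ℤ.+-assoc w 1ℤ (+ r))) (ℤ.+-monoˡ-≤ (1ℤ + + r) -r≤w)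
    where
    cancel : ∀ a → - a + (1ℤ + a) ≡ 1ℤ
    cancel = solve-∀
  v≤x : v ℤ.≤ + x
  v≤x = subst₂ ℤ._≤_ (swap w (+ r)) (cancel (+ x) (+ r)) (ℤ.+-monoˡ-≤ (+ r) (ℤ.i<j⇒suc[i]≤j w<x-r))
    where
    swap : ∀ a b → 1ℤ + a + b ≡ a + 1ℤ + b
    swap = solve-∀
    cancel : ∀ a b → a - b + b ≡ a
    cancel = solve-∀
  b = ℤ.∣ v ∣
  +b≡v : + b ≡ v
  +b≡v = ℤ.0≤i⇒+∣i∣≡i (ℤ.≤-trans (ℤ.+≤+ ℕ.z≤n) 1≤v)
  1≤b : 1 ≤ b
  1≤b = ℤ.drop‿+≤+ (subst (1ℤ ℤ.≤_) (sym +b≡v) 1≤v)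
  b≤x : b ≤ x
  b≤x = ℤ.drop‿+≤+ (subst (ℤ._≤ + x) (sym +b≡v) v≤x)
  +b≡ : + b ≡ v + + countAtLeast b zs
  +b≡ = trans +b≡v (sym (trans (cong (λ n → v + + n) (countAtLeast-< (zs<b +b≡v))) (ℤ.+-identityʳ v)))

-- b is the column with b − 1 − κ′_b = w when rows 1, …, r have length ≥ b, because then
-- κ′_b = r + countAtLeast b zs; the cell in row r and column b joins bead x − r to gap w.
gap-column : ∀ x r zs {w} → Decreasing (x ∷ zs) → w ∉ rowBeads r zs →
             - + (r ℕ.+ length zs) ℤ.≤ w → w ℤ.< + x - + r →
             ∃[ b ] (1 ≤ b × b ≤ x × + b ≡ w + 1ℤ + + r + + countAtLeast b zs)
gap-column x r [] {w} _ _ -r≤w w<x-r =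
  gap-column-base [] (subst (λ n → - + n ℤ.≤ w) (ℕ.+-identityʳ r) -r≤w) w<x-r (λ _ → [])
gap-column x r (z ∷ zs) {w} d w∉ -L≤w w<x-r with ℤ.<-cmp (+ z - + suc r) w
... | tri≈ _ z≡w _ = ⊥-elim (w∉ (here (sym z≡w)))
... | tri< z<w _ _ = gap-column-base (z ∷ zs) -r≤w w<x-r z∷zs<b
  where
  -r≤w : - + r ℤ.≤ w
  -r≤w = subst (ℤ._≤ w) (ℤ.1-[1+n]≡-n r) (ℤ.i<j⇒suc[i]≤j (ℤ.≤-<-trans (ℤ.i≤j+i (- + suc r) (+ z)) z<w))
  z∷zs<b : ∀ {b} → + b ≡ w + 1ℤ + + r → All (_< b) (z ∷ zs)
  z∷zs<b {b} +b≡ = z<b ∷ All.map (λ y≤z → ℕ.≤-<-trans y≤z z<b) (Decreasing⇒≤head (Decreasing-tail d))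
    where
    z<b : z < b
    z<b = ℤ.drop‿+<+ (subst₂ ℤ._<_ (cancel (+ z) (+ r)) (trans (sym (ℤ.+-assoc w 1ℤ (+ r))) (sym +b≡))
                                  (ℤ.+-monoˡ-< (1ℤ + + r) z<w))
      where
      cancel : ∀ a b → a - (1ℤ + b) + (1ℤ + b) ≡ a
      cancel = solve-∀
... | tri> _ _ w<z with gap-column z (suc r) zs (Decreasing-tail d) (w∉ ∘ there)
                                   (subst (λ n → - + n ℤ.≤ w) (ℕ.+-suc r (length zs)) -L≤w) w<z
...   | b , 1≤b , b≤z , +b≡ = b , 1≤b , ℕ.≤-trans b≤z (All.lookup (Decreasing⇒≤head d) (here refl)) , (begin
  + b                                                   ≡⟨ +b≡ ⟩
  w + 1ℤ + (1ℤ + + r) + + countAtLeast b zs             ≡⟨ regroup w (+ r) (+ countAtLeast b zs) ⟩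
  w + 1ℤ + + r + (1ℤ + + countAtLeast b zs)             ≡⟨ cong (λ n → w + 1ℤ + + r + + n) (countAtLeast-∷ zs b≤z) ⟨
  w + 1ℤ + + r + + countAtLeast b (z ∷ zs)              ∎)
  where
  open ≡-Reasoning
  regroup : ∀ w r c → w + 1ℤ + (1ℤ + r) + c ≡ w + 1ℤ + r + (1ℤ + c)
  regroup = solve-∀

hookLength-row : ∀ pre x xs {b} → Decreasing (pre ++ x ∷ xs) → 1 ≤ b → b ≤ x →
                 hookLength (pre ++ x ∷ xs) (suc (length pre) , b) ≡ suc ((x ℕ.∸ b) ℕ.+ countAtLeast b xs)
hookLength-row pre x xs {b} d 1≤b b≤x = begin
  suc ((part κ (suc s) ℕ.∸ b) ℕ.+ (part (conjugate κ) b ℕ.∸ suc s))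
    ≡⟨ cong₂ (λ p q → suc ((p ℕ.∸ b) ℕ.+ (q ℕ.∸ suc s)))
             (part-++ pre x xs)
             (trans (part-conjugate κ b 1≤b (ℕ.≤-trans b≤x (≤-maxPart (∈-++⁺ʳ pre (here refl))))) column-length) ⟩
  suc ((x ℕ.∸ b) ℕ.+ (s ℕ.+ suc c ℕ.∸ suc s))
    ≡⟨ cong (λ n → suc ((x ℕ.∸ b) ℕ.+ (n ℕ.∸ suc s))) (ℕ.+-suc s c) ⟩
  suc ((x ℕ.∸ b) ℕ.+ (suc s ℕ.+ c ℕ.∸ suc s))
    ≡⟨ cong (λ n → suc ((x ℕ.∸ b) ℕ.+ n)) (ℕ.m+n∸m≡n (suc s) c) ⟩
  suc ((x ℕ.∸ b) ℕ.+ c)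
    ∎
  where
  open ≡-Reasoning
  s = length pre
  κ = pre ++ x ∷ xs
  c = countAtLeast b xs
  column-length : countAtLeast b κ ≡ s ℕ.+ suc c
  column-length = begin
    length (filter (b ℕ.≤?_) (pre ++ x ∷ xs))                  ≡⟨ cong length (List.filter-++ (b ℕ.≤?_) pre (x ∷ xs)) ⟩
    length (filter (b ℕ.≤?_) pre ++ filter (b ℕ.≤?_) (x ∷ xs)) ≡⟨ List.length-++ (filter (b ℕ.≤?_) pre) ⟩
    countAtLeast b pre ℕ.+ countAtLeast b (x ∷ xs)             ≡⟨ cong₂ ℕ._+_ (countAtLeast-≥ (All.map (ℕ.≤-trans b≤x) (Decreasing-++⇒≥ pre d)))
                                                                              (countAtLeast-∷ xs b≤x) ⟩
    s ℕ.+ suc c                                                ∎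

gap⇒hook : ∀ h pre x xs → 1 ≤ h → Decreasing (pre ++ x ∷ xs) →
           - + length (pre ++ x ∷ xs) ℤ.≤ + x - + suc (length pre) - + h →
           + x - + suc (length pre) - + h ∉ rowBeads (suc (length pre)) xs →
           Any (λ c → hookLength (pre ++ x ∷ xs) c ≡ h) (cells (pre ++ x ∷ xs))
gap⇒hook h pre x xs 1≤h d -L≤w w∉ =
  lose (cell∈cellsFrom 1 pre x xs b 1≤b b≤x) (trans (hookLength-row pre x xs d 1≤b b≤x) (ℤ.+-injective (sym h≡)))
  where
  s = length pre
  w = + x - + suc s - + h
  column = gap-column x (suc s) xs (Decreasing-++⁻ʳ pre d) w∉
    (subst (λ n → - + n ℤ.≤ w) (trans (List.length-++ pre) (ℕ.+-suc s (length xs))) -L≤w)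
    (subst (w ℤ.<_) (ℤ.+-identityʳ (+ x - + suc s)) (ℤ.+-monoʳ-< (+ x - + suc s) (ℤ.neg-mono-< (ℤ.+<+ 1≤h))))
  b = proj₁ column
  1≤b = proj₁ (proj₂ column)
  b≤x = proj₁ (proj₂ (proj₂ column))
  c = countAtLeast b xs
  h≡ : + h ≡ + suc ((x ℕ.∸ b) ℕ.+ c)
  h≡ = begin
    + h                                          ≡⟨ solve₁ (+ x) (+ suc s) (+ h) (+ c) ⟩
    + x + 1ℤ + + c - (w + 1ℤ + + suc s + + c)    ≡⟨ cong (λ v → + x + 1ℤ + + c - v) (proj₂ (proj₂ (proj₂ column))) ⟨
    + x + 1ℤ + + c - + b                         ≡⟨ solve₂ (+ x) (+ b) (+ c) ⟩
    1ℤ + ((+ x - + b) + + c)                     ≡⟨ cong (λ v → 1ℤ + (v + + c)) (trans (ℤ.[+m]-[+n]≡m⊖n x b) (ℤ.⊖-≥ b≤x)) ⟩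
    1ℤ + (+ (x ℕ.∸ b) + + c)                     ≡⟨ cong (_+_ 1ℤ) (ℤ.pos-+ (x ℕ.∸ b) c) ⟨
    + suc ((x ℕ.∸ b) ℕ.+ c)                      ∎
    where
    open ≡-Reasoning
    solve₁ : ∀ x s h c → h ≡ x + 1ℤ + c - (x - s - h + 1ℤ + s + c)
    solve₁ = solve-∀
    solve₂ : ∀ x b c → x + 1ℤ + c - b ≡ 1ℤ + ((x - b) + c)
    solve₂ = solve-∀

-- Since 1 + 2s ≡ (−1)^s (mod 4), this tracks the sign of row s+1 in
-- oddParts (conjugate κ) = Σ_j (−1)^(j−1) κ_j.
srankFrom : ℕ → List ℕ → ℤ
srankFrom s xs = + oddParts xs - (1ℤ + + 2 * + s) * + oddParts (conjugate xs)

srank≡srankFrom : ∀ κ → srank κ ≡ srankFrom 0 κ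
srank≡srankFrom κ = cong (_-_ (+ oddParts κ)) (sym (ℤ.*-identityˡ (+ oddParts (conjugate κ))))

module _ (δ : ℤ) where

  weight : ℤ → ℤ
  weight y = pronic y + δ

  mod₄-weight : ∀ y → mod₄ (weight y) ≡ pronic₄ (mod₄ y) +₄ mod₄ δ
  mod₄-weight y = trans (mod₄-+ (pronic y) δ) (cong (_+₄ mod₄ δ) (mod₄-pronic y))

  row≡₄ : ∀ s x → odd x - (1ℤ + + 2 * + s) * + x ≡₄ weight (+ x - + suc s) - weight -[1+ s ]
  row≡₄ s x = begin
    mod₄ (odd x - (1ℤ + + 2 * + s) * + x)                 ≡⟨ mod₄-- (odd x) ((1ℤ + + 2 * + s) * + x) ⟩
    mod₄ (odd x) -₄ mod₄ ((1ℤ + + 2 * + s) * + x)         ≡⟨ cong₂ _-₄_ (mod₄-odd x) mod₄-kx ⟩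
    X *₄ X -₄ (1₄ +₄ 2₄ *₄ S) *₄ X                        ≡⟨ law X S (mod₄ δ) ⟩
    pronic₄ (X -₄ suc₄ S) +₄ mod₄ δ -₄ (pronic₄ (-₄ suc₄ S) +₄ mod₄ δ)
                                                          ≡⟨ cong (λ a → pronic₄ a +₄ mod₄ δ -₄ (pronic₄ (-₄ suc₄ S) +₄ mod₄ δ))
                                                                  (mod₄-- (+ x) (+ suc s)) ⟨
    pronic₄ (mod₄ (+ x - + suc s)) +₄ mod₄ δ -₄ (pronic₄ (mod₄ -[1+ s ]) +₄ mod₄ δ)
                                                          ≡⟨ cong₂ _-₄_ (mod₄-weight (+ x - + suc s)) (mod₄-weight -[1+ s ]) ⟨
    mod₄ (weight (+ x - + suc s)) -₄ mod₄ (weight -[1+ s ])         ≡⟨ mod₄-- (weight (+ x - + suc s)) (weight -[1+ s ]) ⟨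
    mod₄ (weight (+ x - + suc s) - weight -[1+ s ])                 ∎
    where
    open ≡-Reasoning
    X = fromℕ₄ x
    S = fromℕ₄ s
    mod₄-kx : mod₄ ((1ℤ + + 2 * + s) * + x) ≡ (1₄ +₄ 2₄ *₄ S) *₄ X
    mod₄-kx = trans (mod₄-* (1ℤ + + 2 * + s) (+ x))
                    (cong (_*₄ X) (trans (mod₄-+ 1ℤ (+ 2 * + s)) (cong (1₄ +₄_) (mod₄-* (+ 2) (+ s)))))
    law : ∀ X S D → X *₄ X -₄ (1₄ +₄ 2₄ *₄ S) *₄ X ≡ pronic₄ (X -₄ suc₄ S) +₄ D -₄ (pronic₄ (-₄ suc₄ S) +₄ D)
    law = from-yes (∀₄? λ X → ∀₄? λ S → ∀₄? λ D →
                      X *₄ X -₄ (1₄ +₄ 2₄ *₄ S) *₄ X ≟₄ pronic₄ (X -₄ suc₄ S) +₄ D -₄ (pronic₄ (-₄ suc₄ S) +₄ D))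

  srankFrom≡₄ : ∀ s xs → Decreasing xs →
                srankFrom s xs ≡₄ sumOver weight (rowBeads s xs) - sumOver weight (seaFrom s (length xs))
  srankFrom≡₄ s []       _ = cong mod₄ (cong (_-_ 0ℤ) (ℤ.*-zeroʳ (1ℤ + + 2 * + s)))
  srankFrom≡₄ s (x ∷ xs) d = begin
    mod₄ (srankFrom s (x ∷ xs))                              ≡⟨ cong mod₄ split ⟩
    mod₄ (row + srankFrom (suc s) xs + + 4 * ((1ℤ + + s) * C)) ≡⟨ +4*≡₄ (row + srankFrom (suc s) xs) ((1ℤ + + s) * C) ⟩
    mod₄ (row + srankFrom (suc s) xs)                        ≡⟨ +-cong₄ row (weight b - weight -[1+ s ]) (srankFrom (suc s) xs) (B - S) (row≡₄ s x)
                                                                         (srankFrom≡₄ (suc s) xs (Decreasing-tail d)) ⟩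
    mod₄ (weight b - weight -[1+ s ] + (B - S))                        ≡⟨ cong mod₄ (interchange (weight b) (weight -[1+ s ]) B S) ⟩
    mod₄ (weight b + B - (weight -[1+ s ] + S))                        ∎
    where
    open ≡-Reasoning
    k = 1ℤ + + 2 * + s
    C = + oddParts (conjugate xs)
    row = odd x - k * + x
    b = + x - + suc s
    B = sumOver weight (rowBeads (suc s) xs)
    S = sumOver weight (seaFrom (suc s) (length xs))
    interchange : ∀ a b c d → a - b + (c - d) ≡ a + c - (b + d)
    interchange = solve-∀
    regroup : ∀ o O x C s → (o + O) - (1ℤ + + 2 * s) * (x - C)
                            ≡ (o - (1ℤ + + 2 * s) * x) + (O - (1ℤ + + 2 * (1ℤ + s)) * C) + + 4 * ((1ℤ + s) * C)
    regroup = solve-∀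
    split : srankFrom s (x ∷ xs) ≡ row + srankFrom (suc s) xs + + 4 * ((1ℤ + + s) * C)
    split = trans (cong₂ (λ o c → o - k * c) (oddParts-∷ x xs) (oddParts-conjugate-∷ x xs d))
                  (regroup (odd x) (+ oddParts xs) (+ x) C (+ s))

-- The t-abacus

module Residues (t : ℕ) .{{_ : NonZero t}} where

  res : ℤ → ℕ
  res x = x %ℕ t

  res<t : ∀ x → res x < t
  res<t x = n%ℕd<d x t

  z<z+t : ∀ z → z ℤ.< z + + t
  z<z+t z = subst (ℤ._< z + + t) (ℤ.+-identityʳ z) (ℤ.+-monoʳ-< z (ℤ.+<+ (ℕ.>-nonZero⁻¹ t)))

  res-+ : ∀ n → n < t → res (+ n) ≡ n
  res-+ n n<t = m<n⇒m%n≡m n<t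

  t≤[1+n]*t : ∀ n → + t ℤ.≤ +[1+ n ] * + t
  t≤[1+n]*t n = subst (+ t ℤ.≤_) (ℤ.pos-* (suc n) t) (ℤ.+≤+ (ℕ.m≤n*m t (suc n)))

  small-multiple≡0 : ∀ q → - + t ℤ.< q * + t → q * + t ℤ.< + t → q ≡ 0ℤ
  small-multiple≡0 (+ zero) _     _    = refl
  small-multiple≡0 +[1+ n ] _     qt<t = ⊥-elim (ℤ.<⇒≱ qt<t (t≤[1+n]*t n))
  small-multiple≡0 -[1+ n ] -t<qt _    =
    ⊥-elim (ℤ.<⇒≱ -t<qt (subst (ℤ._≤ - + t) (ℤ.neg-distribˡ-* +[1+ n ] (+ t)) (ℤ.neg-mono-≤ (t≤[1+n]*t n))))

  remainder-unique : ∀ {r r′} q q′ → r < t → r′ < t → + r + q * + t ≡ + r′ + q′ * + t → r ≡ r′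
  remainder-unique {r} {r′} q q′ r<t r′<t eq = ℤ.+-injective (ℤ.i-j≡0⇒i≡j (+ r) (+ r′) (begin
    + r - + r′                                ≡⟨ difference (+ r) (+ r′) q q′ (+ t) eq ⟩
    (q′ - q) * + t                            ≡⟨ cong (_* + t) q′-q≡0 ⟩
    0ℤ                                        ∎))
    where
    open ≡-Reasoning
    difference : ∀ a b c d e → a + c * e ≡ b + d * e → a - b ≡ (d - c) * e
    difference a b c d e eq = begin
      a - b                           ≡⟨ solve₁ a b c e ⟩
      (a + c * e) - (b + c * e)       ≡⟨ cong (λ u → u - (b + c * e)) eq ⟩
      (b + d * e) - (b + c * e)       ≡⟨ solve₂ b c d e ⟩
      (d - c) * e                     ∎
      where
      solve₁ : ∀ a b c e → a - b ≡ (a + c * e) - (b + c * e)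
      solve₁ = solve-∀
      solve₂ : ∀ b c d e → (b + d * e) - (b + c * e) ≡ (d - c) * e
      solve₂ = solve-∀
    q′-q≡0 : q′ - q ≡ 0ℤ
    q′-q≡0 = small-multiple≡0 (q′ - q)
      (subst (- + t ℤ.<_) (difference (+ r) (+ r′) q q′ (+ t) eq)
             (ℤ.<-≤-trans (ℤ.neg-mono-< (ℤ.+<+ r′<t)) (ℤ.i≤j+i (- + r′) (+ r))))
      (subst (ℤ._< + t) (difference (+ r) (+ r′) q q′ (+ t) eq)
             (ℤ.≤-<-trans (ℤ.i-j≤i (+ r) (+ r′)) (ℤ.+<+ r<t)))

  res-unique : ∀ {x r} q → r < t → x ≡ + r + q * + t → res x ≡ r
  res-unique {x} q r<t eq = remainder-unique (x /ℕ t) q (res<t x) r<t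
                              (trans (sym (a≡a%ℕn+[a/ℕn]*n x t)) eq)

  res-+-multiple : ∀ x q → res (x + q * + t) ≡ res x
  res-+-multiple x q = res-unique (x /ℕ t + q) (res<t x) (begin
    x + q * + t                              ≡⟨ cong (_+ q * + t) (a≡a%ℕn+[a/ℕn]*n x t) ⟩
    + res x + x /ℕ t * + t + q * + t         ≡⟨ regroup (+ res x) (x /ℕ t) q (+ t) ⟩
    + res x + (x /ℕ t + q) * + t             ∎)
    where
    open ≡-Reasoning
    regroup : ∀ r p q t → r + p * t + q * t ≡ r + (p + q) * t
    regroup = solve-∀

  res-≡⇒multiple : ∀ x y → res x ≡ res y → x ≡ y + (x /ℕ t - y /ℕ t) * + t
  res-≡⇒multiple x y eq = begin
    x                                                ≡⟨ a≡a%ℕn+[a/ℕn]*n x t ⟩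
    + res x + x /ℕ t * + t                           ≡⟨ cong (λ r → + r + x /ℕ t * + t) eq ⟩
    + res y + x /ℕ t * + t                           ≡⟨ regroup (+ res y) (x /ℕ t) (y /ℕ t) (+ t) ⟩
    + res y + y /ℕ t * + t + (x /ℕ t - y /ℕ t) * + t ≡⟨ cong (_+ (x /ℕ t - y /ℕ t) * + t) (a≡a%ℕn+[a/ℕn]*n y t) ⟨
    y + (x /ℕ t - y /ℕ t) * + t                      ∎
    where
    open ≡-Reasoning
    regroup : ∀ r p q t → r + p * t ≡ r + q * t + (p - q) * t
    regroup = solve-∀

  res-cong-+ : ∀ x y c → res x ≡ res y → res (x + c) ≡ res (y + c)
  res-cong-+ x y c eq = begin
    res (x + c)                                ≡⟨ cong (λ u → res (u + c)) (res-≡⇒multiple x y eq) ⟩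
    res (y + (x /ℕ t - y /ℕ t) * + t + c)      ≡⟨ cong res (swap y _ c) ⟩
    res (y + c + (x /ℕ t - y /ℕ t) * + t)      ≡⟨ res-+-multiple (y + c) (x /ℕ t - y /ℕ t) ⟩
    res (y + c)                                ∎
    where
    open ≡-Reasoning
    swap : ∀ a b c → a + b + c ≡ a + c + b
    swap = solve-∀

  res-≢-in-window : ∀ {x y} → x ℤ.< y → y ℤ.< x + + t → res x ≢ res y
  res-≢-in-window {x} {y} x<y y<x+t eq = ℤ.<-irrefl (sym y≡x) x<y
    where
    d = y /ℕ t - x /ℕ t
    y≡x+dt : y ≡ x + d * + t
    y≡x+dt = res-≡⇒multiple y x (sym eq)
    dt≡y-x : d * + t ≡ y - x
    dt≡y-x = trans (shift x (d * + t)) (cong (_- x) (sym y≡x+dt))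
      where
      shift : ∀ a b → b ≡ a + b - a
      shift = solve-∀
    0<y-x : 0ℤ ℤ.< y - x
    0<y-x = subst (ℤ._< y - x) (ℤ.+-inverseʳ x) (ℤ.+-monoˡ-< (- x) x<y)
    y-x<t : y - x ℤ.< + t
    y-x<t = subst (y - x ℤ.<_) (cancel x (+ t)) (ℤ.+-monoˡ-< (- x) y<x+t)
      where
      cancel : ∀ a b → a + b - a ≡ b
      cancel = solve-∀
    d≡0 : d ≡ 0ℤ
    d≡0 = small-multiple≡0 d
      (subst (- + t ℤ.<_) (sym dt≡y-x) (ℤ.<-trans (ℤ.neg-mono-< (ℤ.+<+ (ℕ.>-nonZero⁻¹ t))) 0<y-x))
      (subst (ℤ._< + t) (sym dt≡y-x) y-x<t)
    y≡x : y ≡ x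
    y≡x = trans y≡x+dt (trans (cong (λ u → x + u * + t) d≡0) (ℤ.+-identityʳ x))

  res-+t : ∀ z → res (z + + t) ≡ res z
  res-+t z = trans (cong res (plus z (+ t))) (res-+-multiple z 1ℤ)
    where
    plus : ∀ z t → z + t ≡ z + 1ℤ * t
    plus = solve-∀

  res-‿t : ∀ z → res (z - + t) ≡ res z
  res-‿t z = trans (cong res (minus z (+ t))) (res-+-multiple z (- 1ℤ))
    where
    minus : ∀ z t → z - t ≡ z + - 1ℤ * t
    minus = solve-∀

module Abacus (t : ℕ) .{{_ : NonZero t}} where

  open Residues t

  onRunner : ℕ → ℤ → ℤ
  onRunner i x = 𝟙 (res x ℕ.≟ i)

  onRunner-res : ∀ x → onRunner (res x) x ≡ 1ℤ
  onRunner-res x with res x ℕ.≟ res x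
  ... | yes _  = refl
  ... | no neq = ⊥-elim (neq refl)

  onRunner-≢ : ∀ {i} x → res x ≢ i → onRunner i x ≡ 0ℤ
  onRunner-≢ {i} x neq with res x ℕ.≟ i
  ... | yes eq = ⊥-elim (neq eq)
  ... | no _   = refl

  onRunner-in-window : ∀ {x y} → x ℤ.< y → y ℤ.< x + + t → onRunner (res y) x ≡ 0ℤ
  onRunner-in-window {x} x<y y<x+t = onRunner-≢ x (res-≢-in-window x<y y<x+t)

  onRunner-suc : ∀ i z → i < t → onRunner (suc i % t) (z + 1ℤ) ≡ onRunner i z
  onRunner-suc i z i<t = 𝟙-cong ⇒ ⇐ (res (z + 1ℤ) ℕ.≟ suc i % t) (res z ℕ.≟ i)
    where
    cancel : ∀ z → z + 1ℤ - 1ℤ ≡ z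
    cancel = solve-∀
    ⇒ : res (z + 1ℤ) ≡ suc i % t → res z ≡ i
    ⇒ eq = trans (trans (cong res (sym (cancel z))) (res-cong-+ (z + 1ℤ) (+ suc i) (- 1ℤ) eq)) (res-+ i i<t)
    ⇐ : res z ≡ i → res (z + 1ℤ) ≡ suc i % t
    ⇐ eq = trans (res-cong-+ z (+ i) 1ℤ (trans eq (sym (res-+ i i<t)))) (cong (λ n → res (+ n)) (ℕ.+-comm i 1))

  -- The charge of runner i for the beads ys together with every position below −L.
  charge : List ℤ → ℕ → ℕ → ℤ
  charge ys L i = sumOver (onRunner i) ys - sumOver (onRunner i) (seaFrom 0 L)

  charge-∷ : ∀ y ys L i → charge (y ∷ ys) L i ≡ onRunner i y + charge ys L i
  charge-∷ y ys L i = ℤ.+-assoc (onRunner i y) _ _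

  charge-sea : ∀ L i → charge [] (suc L) i ≡ charge [] L i - onRunner i -[1+ L ]
  charge-sea L i = trans (cong (λ s → 0ℤ - s) (sumOver-seaFrom-suc (onRunner i) 0 L))
                         (regroup (sumOver (onRunner i) (seaFrom 0 L)) (onRunner i -[1+ L ]))
    where
    regroup : ∀ a b → 0ℤ - (a + b) ≡ 0ℤ - a - b
    regroup = solve-∀

  vacuum-position : ∀ L z → - + L ℤ.≤ z → z ℤ.< - + L + + t → z ≡ + res z + + t * charge [] L (res z)
  vacuum-position zero (+ n) _ n<t = trans (sym (ℤ.+-identityʳ (+ n)))
    (cong₂ (λ r c → + r + c) (sym (res-+ n (ℤ.drop‿+<+ n<t))) (sym (ℤ.*-zeroʳ (+ t))))
  vacuum-position (suc L) z -L-1≤z z<-L-1+t with z ℤ.≟ -[1+ L ]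
  ... | yes refl = begin
    z                                                         ≡⟨ cancel z (+ t) ⟩
    z + + t - + t                                             ≡⟨ cong (_- + t) (vacuum-position L (z + + t) lower upper) ⟩
    + res (z + + t) + + t * charge [] L (res (z + + t)) - + t ≡⟨ cong (λ r → + r + + t * charge [] L r - + t) (res-+t z) ⟩
    + res z + + t * charge [] L (res z) - + t                 ≡⟨ regroup (+ res z) (+ t) (charge [] L (res z)) ⟩
    + res z + + t * (charge [] L (res z) - 1ℤ)               ≡⟨ cong (λ c → + res z + + t * c) charge-drops ⟨
    + res z + + t * charge [] (suc L) (res z)                 ∎
    where
    open ≡-Reasoning
    cancel : ∀ a b → a ≡ a + b - b
    cancel = solve-∀
    regroup : ∀ r t c → r + t * c - t ≡ r + t * (c - 1ℤ)
    regroup = solve-∀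
    lower : - + L ℤ.≤ z + + t
    lower = subst₂ ℤ._≤_ (ℤ.1-[1+n]≡-n L) (ℤ.+-comm (+ t) z) (ℤ.+-monoˡ-≤ z {1ℤ} {+ t} (ℤ.+≤+ (ℕ.>-nonZero⁻¹ t)))
    upper : z + + t ℤ.< - + L + + t
    upper = ℤ.+-monoˡ-< (+ t) (-[1+n]<-n L)
    charge-drops : charge [] (suc L) (res z) ≡ charge [] L (res z) - 1ℤ
    charge-drops = trans (charge-sea L (res z)) (cong (_-_ (charge [] L (res z))) (onRunner-res z))
  ... | no z≢-L-1 = begin
    z                                                          ≡⟨ vacuum-position L z -L≤z z<-L+t ⟩
    + res z + + t * charge [] L (res z)                        ≡⟨ cong (λ c → + res z + + t * c) charge-stays ⟨
    + res z + + t * charge [] (suc L) (res z)                  ∎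
    where
    open ≡-Reasoning
    -L-1<z : -[1+ L ] ℤ.< z
    -L-1<z = ℤ.≤∧≢⇒< -L-1≤z (z≢-L-1 ∘ sym)
    -L≤z : - + L ℤ.≤ z
    -L≤z = subst (ℤ._≤ z) (ℤ.1-[1+n]≡-n L) (ℤ.i<j⇒suc[i]≤j -L-1<z)
    z<-L+t : z ℤ.< - + L + + t
    z<-L+t = ℤ.<-≤-trans z<-L-1+t (ℤ.+-monoˡ-≤ (+ t) (ℤ.<⇒≤ (-[1+n]<-n L)))
    charge-stays : charge [] (suc L) (res z) ≡ charge [] L (res z)
    charge-stays = trans (charge-sea L (res z))
                         (trans (cong (_-_ (charge [] L (res z))) (onRunner-in-window -L-1<z z<-L-1+t)) (ℤ.+-identityʳ _))

  Stackable : ℕ → List ℤ → ℤ → Set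
  Stackable L ys z = All (ℤ._< z) ys × - + L ℤ.≤ z × (z - + t ∈ ys ⊎ z - + t ℤ.< - + L)

  data Closed (L : ℕ) : List ℤ → Set where
    []  : Closed L []
    _∷_ : ∀ {y ys} → Stackable L ys y → Closed L ys → Closed L (y ∷ ys)

  charge-skip : ∀ {y z} ys L → z - + t ℤ.< y → y ℤ.< z → charge (y ∷ ys) L (res z) ≡ charge ys L (res z)
  charge-skip {y} {z} ys L z-t<y y<z = begin
    charge (y ∷ ys) L (res z)                ≡⟨ charge-∷ y ys L (res z) ⟩
    onRunner (res z) y + charge ys L (res z) ≡⟨ cong (_+ charge ys L (res z)) (onRunner-≢ y res-y≢res-z) ⟩
    0ℤ + charge ys L (res z)                 ≡⟨ ℤ.+-identityˡ _ ⟩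
    charge ys L (res z)                      ∎
    where
    open ≡-Reasoning
    res-y≢res-z : res y ≢ res z
    res-y≢res-z eq = res-≢-in-window z-t<y (subst (y ℤ.<_) (cancel z (+ t)) y<z) (trans (res-‿t z) (sym eq))
      where
      cancel : ∀ a b → a ≡ a - b + b
      cancel = solve-∀

  -- On a closed configuration every runner is filled contiguously from −∞, so a bead stacked
  -- on top of runner r sits at r + t · charge.
  stackable-position : ∀ {L ys z} → Closed L ys → Stackable L ys z → z ≡ + res z + + t * charge ys L (res z)
  stackable-position {L} {[]} {z} [] (_ , -L≤z , inj₂ z-t<-L) =
    vacuum-position L z -L≤z (subst (ℤ._< - + L + + t) (cancel z (+ t)) (ℤ.+-monoˡ-< (+ t) z-t<-L))
    where
    cancel : ∀ a b → a - b + b ≡ a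
    cancel = solve-∀
  stackable-position {L} {y ∷ ys} {z} (stk-y ∷ cl) (y<z ∷ ys<z , -L≤z , inj₁ (here z-t≡y)) = begin
    z                                              ≡⟨ cancel z (+ t) ⟩
    z - + t + + t                                  ≡⟨ cong (_+ + t) z-t≡y ⟩
    y + + t                                        ≡⟨ cong (_+ + t) (stackable-position cl stk-y) ⟩
    + res y + + t * charge ys L (res y) + + t      ≡⟨ regroup (+ res y) (+ t) (charge ys L (res y)) ⟩
    + res y + + t * (1ℤ + charge ys L (res y))     ≡⟨ cong (λ c → + res y + + t * c) charge-rises ⟨
    + res y + + t * charge (y ∷ ys) L (res y)      ≡⟨ cong (λ r → + r + + t * charge (y ∷ ys) L r) res-y≡res-z ⟩
    + res z + + t * charge (y ∷ ys) L (res z)      ∎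
    where
    open ≡-Reasoning
    cancel : ∀ a b → a ≡ a - b + b
    cancel = solve-∀
    regroup : ∀ r t c → r + t * c + t ≡ r + t * (1ℤ + c)
    regroup = solve-∀
    charge-rises : charge (y ∷ ys) L (res y) ≡ 1ℤ + charge ys L (res y)
    charge-rises = trans (charge-∷ y ys L (res y)) (cong (_+ charge ys L (res y)) (onRunner-res y))
    res-y≡res-z : res y ≡ res z
    res-y≡res-z = trans (cong res (sym z-t≡y)) (res-‿t z)
  stackable-position {L} {y ∷ ys} {z} ((ys<y , _) ∷ cl) (y<z ∷ ys<z , -L≤z , inj₁ (there z-t∈ys)) =
    trans (stackable-position cl (ys<z , -L≤z , inj₁ z-t∈ys))
          (cong (λ c → + res z + + t * c) (sym (charge-skip ys L (All.lookup ys<y z-t∈ys) y<z)))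
  stackable-position {L} {y ∷ ys} {z} ((_ , -L≤y , _) ∷ cl) (y<z ∷ ys<z , -L≤z , inj₂ z-t<-L) =
    trans (stackable-position cl (ys<z , -L≤z , inj₂ z-t<-L))
          (cong (λ c → + res z + + t * c) (sym (charge-skip ys L (ℤ.<-≤-trans z-t<-L -L≤y) y<z)))

  module Accumulation (f : ℤ → ℕ → ℤ) (q : ℤ → ℤ)
                      (step : ∀ n i → f (n + 1ℤ) i ≡₄ f n i + q (+ i + + t * n)) where

    ∑f : (ℕ → ℤ) → ℤ
    ∑f M = ∑ t (λ i → f (M i) i)

    ∑f₀ : ℤ
    ∑f₀ = ∑f (λ _ → 0ℤ)

    add-bead : ∀ (M M′ : ℕ → ℤ) r → r < t → M′ r ≡ M r + 1ℤ → (∀ j → j ≢ r → M′ j ≡ M j) →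
              ∑f M′ ≡₄ ∑f M + q (+ r + + t * M r)
    add-bead M M′ r r<t M′r≡Mr+1 M′j≡Mj = begin
      mod₄ (∑f M′)                                       ≡⟨ cong mod₄ (∑-update t _ _ r r<t (λ j j≢r → cong (λ n → f n j) (M′j≡Mj j j≢r))) ⟩
      mod₄ (∑f M + (f (M′ r) r - f (M r) r))             ≡⟨ mod₄-+ (∑f M) _ ⟩
      mod₄ (∑f M) +₄ mod₄ (f (M′ r) r - f (M r) r)       ≡⟨ cong (mod₄ (∑f M) +₄_) increment ⟩
      mod₄ (∑f M) +₄ mod₄ (q z)                          ≡⟨ mod₄-+ (∑f M) (q z) ⟨
      mod₄ (∑f M + q z)                                  ∎
      where
      open ≡-Reasoning
      z = + r + + t * M r
      increment : mod₄ (f (M′ r) r - f (M r) r) ≡ mod₄ (q z)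
      increment = begin
        mod₄ (f (M′ r) r - f (M r) r)                    ≡⟨ cong (λ n → mod₄ (f n r - f (M r) r)) M′r≡Mr+1 ⟩
        mod₄ (f (M r + 1ℤ) r - f (M r) r)                ≡⟨ mod₄-- (f (M r + 1ℤ) r) (f (M r) r) ⟩
        mod₄ (f (M r + 1ℤ) r) -₄ mod₄ (f (M r) r)        ≡⟨ cong (_-₄ mod₄ (f (M r) r)) (trans (step (M r) r) (mod₄-+ (f (M r) r) (q z))) ⟩
        mod₄ (f (M r) r) +₄ mod₄ (q z) -₄ mod₄ (f (M r) r) ≡⟨ cancel (mod₄ (f (M r) r)) (mod₄ (q z)) ⟩
        mod₄ (q z)                                       ∎
        where
        cancel : ∀ a b → a +₄ b -₄ a ≡ b
        cancel = from-yes (∀₄? λ a → ∀₄? λ b → a +₄ b -₄ a ≟₄ b)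

    accumulate-sea : ∀ L → ∑f (charge [] L) ≡₄ ∑f₀ - sumOver q (seaFrom 0 L)
    accumulate-sea zero    = cong mod₄ (sym (ℤ.+-identityʳ ∑f₀))
    accumulate-sea (suc L) = begin
      mod₄ (∑f M)                                      ≡⟨ x+y≡₄z⇒x≡₄z-y (∑f M) (q -[1+ L ]) (∑f₀ - sea)
                                                                         (trans (sym removed) (accumulate-sea L)) ⟩
      mod₄ (∑f₀ - sea - q -[1+ L ])                    ≡⟨ cong mod₄ (regroup ∑f₀ sea (q -[1+ L ])) ⟩
      mod₄ (∑f₀ - (sea + q -[1+ L ]))                  ≡⟨ cong (λ s → mod₄ (∑f₀ - s)) (sumOver-seaFrom-suc q 0 L) ⟨
      mod₄ (∑f₀ - sumOver q (seaFrom 0 (suc L)))       ∎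
      where
      open ≡-Reasoning
      M  = charge [] (suc L)
      M′ = charge [] L
      r  = res -[1+ L ]
      sea = sumOver q (seaFrom 0 L)
      regroup : ∀ a b c → a - b - c ≡ a - (b + c)
      regroup = solve-∀
      M′-M : ∀ j → M′ j ≡ M j + onRunner j -[1+ L ]
      M′-M j = trans (cancel (M′ j) (onRunner j -[1+ L ])) (cong (_+ onRunner j -[1+ L ]) (sym (charge-sea L j)))
        where
        cancel : ∀ a b → a ≡ a - b + b
        cancel = solve-∀
      removed : ∑f M′ ≡₄ ∑f M + q -[1+ L ]
      removed = subst (λ z → ∑f M′ ≡₄ ∑f M + q z)
        (sym (vacuum-position (suc L) -[1+ L ] ℤ.≤-refl (z<z+t -[1+ L ])))
        (add-bead M M′ r (res<t -[1+ L ]) (trans (M′-M r) (cong (_+_ (M r)) (onRunner-res -[1+ L ])))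
                  (λ j j≢r → trans (M′-M j) (trans (cong (_+_ (M j)) (onRunner-≢ -[1+ L ] (j≢r ∘ sym))) (ℤ.+-identityʳ (M j)))))

    accumulate : ∀ {L ys} → Closed L ys → ∑f (charge ys L) ≡₄ ∑f₀ + sumOver q ys - sumOver q (seaFrom 0 L)
    accumulate {L} [] = trans (accumulate-sea L) (cong mod₄ (insert-zero ∑f₀ (sumOver q (seaFrom 0 L))))
      where
      insert-zero : ∀ a b → a - b ≡ a + 0ℤ - b
      insert-zero = solve-∀
    accumulate {L} {y ∷ ys} (stk ∷ cl) = begin
      mod₄ (∑f M′)                             ≡⟨ subst (λ z → ∑f M′ ≡₄ ∑f M + q z) (sym (stackable-position cl stk)) added ⟩
      mod₄ (∑f M + q y)                        ≡⟨ +-cong₄ (∑f M) (∑f₀ + sumOver q ys - sea) (q y) (q y) (accumulate cl) refl ⟩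
      mod₄ (∑f₀ + sumOver q ys - sea + q y)    ≡⟨ cong mod₄ (regroup ∑f₀ (sumOver q ys) sea (q y)) ⟩
      mod₄ (∑f₀ + (q y + sumOver q ys) - sea)  ∎
      where
      open ≡-Reasoning
      M  = charge ys L
      M′ = charge (y ∷ ys) L
      sea = sumOver q (seaFrom 0 L)
      regroup : ∀ a b c d → a + b - c + d ≡ a + (d + b) - c
      regroup = solve-∀
      added : ∑f M′ ≡₄ ∑f M + q (+ res y + + t * M (res y))
      added = add-bead M M′ (res y) (res<t y)
        (trans (charge-∷ y ys L (res y)) (trans (cong (_+ M (res y)) (onRunner-res y)) (ℤ.+-comm 1ℤ (M (res y)))))
        (λ j j≢r → trans (charge-∷ y ys L j) (trans (cong (_+ M j) (onRunner-≢ y (j≢r ∘ sym))) (ℤ.+-identityˡ (M j))))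

  residueCountIn : ℕ → List (ℕ × ℕ) → ℤ
  residueCountIn i cs = + length (filter (λ c → (+ proj₂ c - + proj₁ c) %ℕ t ℕ.≟ i) cs)

  residueCount-row : ∀ r x i →
    residueCountIn i (map (λ b → (r , b)) (map suc (upTo x))) ≡ ∑ x (λ k → onRunner i (+ suc k - + r))
  residueCount-row r x i =
    trans (cong (residueCountIn i)
                (trans (cong (map (λ b → (r , b))) (List.map-upTo suc x)) (List.map-applyUpTo suc (λ b → (r , b)) x)))
          (length-filter-applyUpTo _ (λ k → (r , suc k)) x)

  residueDifference-row : ∀ r x i → i < t →
    ∑ x (λ k → onRunner i (+ suc k - + r)) - ∑ x (λ k → onRunner (suc i % t) (+ suc k - + r))
    ≡ onRunner i (+ x - + r) - onRunner i (+ 0 - + r)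
  residueDifference-row r x i i<t = begin
    ∑ x (λ k → onRunner i (+ suc k - + r)) - ∑ x (λ k → onRunner (suc i % t) (+ suc k - + r))
      ≡⟨ ∑-distrib-‿- x _ _ ⟨
    ∑ x (λ k → onRunner i (+ suc k - + r) - onRunner (suc i % t) (+ suc k - + r))
      ≡⟨ ∑-cong x (λ k _ → cong (_-_ (onRunner i (+ suc k - + r))) shifted) ⟩
    ∑ x (λ k → onRunner i (+ suc k - + r) - onRunner i (+ k - + r))
      ≡⟨ ∑-telescope x (λ k → onRunner i (+ k - + r)) ⟩
    onRunner i (+ x - + r) - onRunner i (+ 0 - + r)
      ∎
    where
    open ≡-Reasoning
    shifted : ∀ {k} → onRunner (suc i % t) (+ suc k - + r) ≡ onRunner i (+ k - + r)
    shifted {k} = trans (cong (onRunner (suc i % t)) (plus-one (+ k) (+ r))) (onRunner-suc i (+ k - + r) i<t)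
      where
      plus-one : ∀ a b → 1ℤ + a - b ≡ a - b + 1ℤ
      plus-one = solve-∀

  residueDifference : ∀ s xs i → i < t →
    residueCountIn i (cellsFrom (suc s) xs) - residueCountIn (suc i % t) (cellsFrom (suc s) xs)
    ≡ sumOver (onRunner i) (rowBeads s xs) - sumOver (onRunner i) (seaFrom s (length xs))
  residueDifference s []       i i<t = refl
  residueDifference s (x ∷ xs) i i<t = begin
    residueCountIn i (row ++ rest) - residueCountIn i′ (row ++ rest)
      ≡⟨ cong₂ _-_ (length-filter-++ _ row rest) (length-filter-++ _ row rest) ⟩
    (residueCountIn i row + residueCountIn i rest) - (residueCountIn i′ row + residueCountIn i′ rest)
      ≡⟨ interchange (residueCountIn i row) (residueCountIn i rest) (residueCountIn i′ row) (residueCountIn i′ rest) ⟩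
    (residueCountIn i row - residueCountIn i′ row) + (residueCountIn i rest - residueCountIn i′ rest)
      ≡⟨ cong₂ _+_ (trans (cong₂ _-_ (residueCount-row (suc s) x i) (residueCount-row (suc s) x i′))
                          (residueDifference-row (suc s) x i i<t))
                   (residueDifference (suc s) xs i i<t) ⟩
    (onRunner i (+ x - + suc s) - onRunner i -[1+ s ]) + (B - S)
      ≡⟨ interchange′ (onRunner i (+ x - + suc s)) (onRunner i -[1+ s ]) B S ⟩
    (onRunner i (+ x - + suc s) + B) - (onRunner i -[1+ s ] + S)
      ∎
    where
    open ≡-Reasoning
    i′ = suc i % t
    row  = map (λ b → (suc s , b)) (map suc (upTo x))
    rest = cellsFrom (suc (suc s)) xs
    B = sumOver (onRunner i) (rowBeads (suc s) xs)
    S = sumOver (onRunner i) (seaFrom (suc s) (length xs))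
    interchange : ∀ a b c d → (a + b) - (c + d) ≡ (a - c) + (b - d)
    interchange = solve-∀
    interchange′ : ∀ a b c d → (a - b) + (c - d) ≡ (a + c) - (b + d)
    interchange′ = solve-∀

  nvec≡charge : ∀ κ i → i < t → nvec t κ i ≡ charge (rowBeads 0 κ) (length κ) i
  nvec≡charge κ i i<t = residueDifference 0 κ i i<t

  core⇒closed-from : ∀ pre xs → Decreasing (pre ++ xs) → IsCore t (pre ++ xs) →
                     Closed (length (pre ++ xs)) (rowBeads (length pre) xs)
  core⇒closed-from pre []       d core = []
  core⇒closed-from pre (x ∷ xs) d core = (below , lower , predecessor) ∷ rest
    where
    s = length pre
    L = length (pre ++ x ∷ xs)
    y = + x - + suc s
    below : All (ℤ._< y) (rowBeads (suc s) xs)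
    below = rowBeads-below s (suc s) xs ℕ.≤-refl (Decreasing⇒≤head (Decreasing-++⁻ʳ pre d))
    lower : - + L ℤ.≤ y
    lower = ℤ.≤-trans (ℤ.neg-mono-≤ (ℤ.+≤+ s<L)) (ℤ.i≤j+i (- + suc s) (+ x))
      where
      s<L : suc s ≤ L
      s<L = subst (suc s ≤_) (sym (trans (List.length-++ pre) (ℕ.+-suc s (length xs)))) (ℕ.s≤s (ℕ.m≤m+n s _))
    predecessor : y - + t ∈ rowBeads (suc s) xs ⊎ y - + t ℤ.< - + L
    predecessor with y - + t ∈? rowBeads (suc s) xs | y - + t ℤ.<? - + L
    ... | yes y-t∈ | _          = inj₁ y-t∈
    ... | no _     | yes y-t<-L = inj₂ y-t<-L
    ... | no y-t∉  | no y-t≮-L  = ⊥-elim (core (gap⇒hook t pre x xs (ℕ.>-nonZero⁻¹ t) d (ℤ.≮⇒≥ y-t≮-L) y-t∉))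
    assoc : pre ++ x ∷ xs ≡ (pre ++ (x ∷ [])) ++ xs
    assoc = sym (List.++-assoc pre (x ∷ []) xs)
    rest : Closed L (rowBeads (suc s) xs)
    rest = subst₂ Closed (cong length (sym assoc)) (cong (λ n → rowBeads n xs) (trans (List.length-++ pre) (ℕ.+-comm s 1)))
                  (core⇒closed-from (pre ++ (x ∷ [])) xs (subst Decreasing assoc d) (subst (IsCore t) assoc core))

  core⇒closed : ∀ κ → Decreasing κ → IsCore t κ → Closed (length κ) (rowBeads 0 κ)
  core⇒closed = core⇒closed-from []

srank≡₄∑ : ∀ t .{{_ : NonZero t}} (f : ℤ → ℕ → ℤ) (δ : ℤ) →
           (∀ n i → f (n + 1ℤ) i ≡₄ f n i + (pronic (+ i + + t * n) + δ)) →
           ∑ t (λ i → f 0ℤ i) ≡₄ 0ℤ →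
           ∀ κ → Decreasing κ → IsCore t κ → srank κ ≡₄ sumTo t (λ i → f (nvec t κ i) i)
srank≡₄∑ t f δ step ∑f₀≡₄0 κ d core = begin
  mod₄ (srank κ)                                  ≡⟨ cong mod₄ (srank≡srankFrom κ) ⟩
  mod₄ (srankFrom 0 κ)                            ≡⟨ srankFrom≡₄ δ 0 κ d ⟩
  mod₄ (B - S)                                    ≡⟨ cong (_+₄ mod₄ (B - S)) ∑f₀≡₄0 ⟨
  mod₄ (∑f₀) +₄ mod₄ (B - S)                      ≡⟨ mod₄-+ ∑f₀ (B - S) ⟨
  mod₄ (∑f₀ + (B - S))                            ≡⟨ cong mod₄ (ℤ.+-assoc ∑f₀ B (- S)) ⟨
  mod₄ (∑f₀ + B - S)                              ≡⟨ accumulate (core⇒closed κ d core) ⟨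
  mod₄ (∑ t (λ i → f (charge beads L i) i))       ≡⟨ cong mod₄ (trans (sumTo≡∑ t _) (∑-cong t nvec≡charge′)) ⟨
  mod₄ (sumTo t (λ i → f (nvec t κ i) i))         ∎
  where
  open ≡-Reasoning
  open Abacus t
  open Accumulation f (weight δ) step
  beads = rowBeads 0 κ
  L = length κ
  B = sumOver (weight δ) beads
  S = sumOver (weight δ) (seaFrom 0 L)
  nvec≡charge′ : ∀ i → i < t → f (nvec t κ i) i ≡ f (charge beads L i) i
  nvec≡charge′ i i<t = cong (λ n → f n i) (nvec≡charge κ i i<t)

-- The two congruences

step-by-reduction : ∀ (f : ℤ → ℕ → ℤ) (F : ℤ₄ → ℤ₄ → ℤ₄) t δ →
                    (∀ n i → mod₄ (f n i) ≡ F (mod₄ n) (fromℕ₄ i)) →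
                    (∀ N I → F (N +₄ 1₄) I ≡ F N I +₄ (pronic₄ (I +₄ fromℕ₄ t *₄ N) +₄ mod₄ δ)) →
                    ∀ n i → f (n + 1ℤ) i ≡₄ f n i + (pronic (+ i + + t * n) + δ)
step-by-reduction f F t δ mod₄-f law n i = begin
  mod₄ (f (n + 1ℤ) i)                                                 ≡⟨ mod₄-f (n + 1ℤ) i ⟩
  F (mod₄ (n + 1ℤ)) I                                                 ≡⟨ cong (λ m → F m I) (mod₄-+ n 1ℤ) ⟩
  F (N +₄ 1₄) I                                                       ≡⟨ law N I ⟩
  F N I +₄ (pronic₄ (I +₄ fromℕ₄ t *₄ N) +₄ mod₄ δ)                   ≡⟨ cong₂ _+₄_ (mod₄-f n i) (cong (_+₄ mod₄ δ) mod₄-pronic-i+tn) ⟨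
  mod₄ (f n i) +₄ (mod₄ (pronic (+ i + + t * n)) +₄ mod₄ δ)           ≡⟨ cong (mod₄ (f n i) +₄_) (mod₄-+ (pronic (+ i + + t * n)) δ) ⟨
  mod₄ (f n i) +₄ mod₄ (pronic (+ i + + t * n) + δ)                   ≡⟨ mod₄-+ (f n i) (pronic (+ i + + t * n) + δ) ⟨
  mod₄ (f n i + (pronic (+ i + + t * n) + δ))                         ∎
  where
  open ≡-Reasoning
  N = mod₄ n
  I = fromℕ₄ i
  mod₄-pronic-i+tn : mod₄ (pronic (+ i + + t * n)) ≡ pronic₄ (I +₄ fromℕ₄ t *₄ N)
  mod₄-pronic-i+tn = trans (mod₄-pronic (+ i + + t * n)) (cong pronic₄ (trans (mod₄-+ (+ i) (+ t * n)) (cong (I +₄_) (mod₄-* (+ t) n))))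

cubic : ℕ → ℤ → ℕ → ℤ
cubic a n i = let x = n + (+ 1 - + 2 * + a) * + i + + a in x * x * x

cubic₄ : ℤ₄ → ℤ₄ → ℤ₄ → ℤ₄
cubic₄ A N I = let x = N +₄ (1₄ -₄ 2₄ *₄ A) *₄ I +₄ A in x *₄ x *₄ x

mod₄-cubic : ∀ a n i → mod₄ (cubic a n i) ≡ cubic₄ (fromℕ₄ a) (mod₄ n) (fromℕ₄ i)
mod₄-cubic a n i = trans (mod₄-* (x * x) x) (trans (cong (_*₄ mod₄ x) (mod₄-* x x)) (cong (λ y → y *₄ y *₄ y) mod₄-x))
  where
  x = n + (+ 1 - + 2 * + a) * + i + + a
  mod₄-x : mod₄ x ≡ mod₄ n +₄ (1₄ -₄ 2₄ *₄ fromℕ₄ a) *₄ fromℕ₄ i +₄ fromℕ₄ a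
  mod₄-x = begin
    mod₄ x                                                            ≡⟨ mod₄-+ (n + (+ 1 - + 2 * + a) * + i) (+ a) ⟩
    mod₄ (n + (+ 1 - + 2 * + a) * + i) +₄ fromℕ₄ a                    ≡⟨ cong (_+₄ fromℕ₄ a) (mod₄-+ n ((+ 1 - + 2 * + a) * + i)) ⟩
    mod₄ n +₄ mod₄ ((+ 1 - + 2 * + a) * + i) +₄ fromℕ₄ a              ≡⟨ cong (λ y → mod₄ n +₄ y +₄ fromℕ₄ a) (mod₄-* (+ 1 - + 2 * + a) (+ i)) ⟩
    mod₄ n +₄ mod₄ (+ 1 - + 2 * + a) *₄ fromℕ₄ i +₄ fromℕ₄ a          ≡⟨ cong (λ y → mod₄ n +₄ y *₄ fromℕ₄ i +₄ fromℕ₄ a)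
                                                                              (trans (mod₄-- (+ 1) (+ 2 * + a)) (cong (_-₄_ 1₄) (mod₄-* (+ 2) (+ a)))) ⟩
    mod₄ n +₄ (1₄ -₄ 2₄ *₄ fromℕ₄ a) *₄ fromℕ₄ i +₄ fromℕ₄ a          ∎
    where open ≡-Reasoning

cubic-step : ∀ a t → t % 4 ≡ (1 ℕ.+ 2 ℕ.* a) % 4 →
             ∀ n i → cubic a (n + 1ℤ) i ≡₄ cubic a n i + (pronic (+ i + + t * n) + (1ℤ + pronic (+ a)))
cubic-step a t t≡ = step-by-reduction (cubic a) (cubic₄ A) t (1ℤ + pronic (+ a)) (mod₄-cubic a) (λ N I → begin
  cubic₄ A (N +₄ 1₄) I                                                       ≡⟨ law A N I ⟩
  cubic₄ A N I +₄ (pronic₄ (I +₄ suc₄ (2₄ *₄ A) *₄ N) +₄ (1₄ +₄ pronic₄ A))  ≡⟨ cong₂ (λ T D → cubic₄ A N I +₄ (pronic₄ (I +₄ T *₄ N) +₄ D))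
                                                                                      T≡ D≡ ⟩
  cubic₄ A N I +₄ (pronic₄ (I +₄ fromℕ₄ t *₄ N) +₄ mod₄ (1ℤ + pronic (+ a))) ∎)
  where
  open ≡-Reasoning
  A = fromℕ₄ a
  T≡ : suc₄ (2₄ *₄ A) ≡ fromℕ₄ t
  T≡ = trans (cong suc₄ (sym (fromℕ₄-* 2 a))) (fromℕ₄-cong (1 ℕ.+ 2 ℕ.* a) t (sym t≡))
  D≡ : 1₄ +₄ pronic₄ A ≡ mod₄ (1ℤ + pronic (+ a))
  D≡ = sym (trans (mod₄-+ 1ℤ (pronic (+ a))) (cong (1₄ +₄_) (mod₄-pronic (+ a))))
  law : ∀ A N I → cubic₄ A (N +₄ 1₄) I ≡ cubic₄ A N I +₄ (pronic₄ (I +₄ suc₄ (2₄ *₄ A) *₄ N) +₄ (1₄ +₄ pronic₄ A))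
  law = from-yes (∀₄? λ A → ∀₄? λ N → ∀₄? λ I →
          cubic₄ A (N +₄ 1₄) I ≟₄ cubic₄ A N I +₄ (pronic₄ (I +₄ suc₄ (2₄ *₄ A) *₄ N) +₄ (1₄ +₄ pronic₄ A)))

cubic-sum : ∀ a t → t % 4 ≡ (1 ℕ.+ 2 ℕ.* a) % 4 → ∑ t (cubic a 0ℤ) ≡₄ 0ℤ
cubic-sum a t t≡ = begin
  mod₄ (∑ t (cubic a 0ℤ))                        ≡⟨ ∑-periodic₄ t (cubic a 0ℤ) (cubic₄ A 0₄) (mod₄-cubic a 0ℤ) (period A) ⟩
  partialSum₄ (cubic₄ A 0₄) (fromℕ₄ t)           ≡⟨ cong (partialSum₄ (cubic₄ A 0₄)) (trans (fromℕ₄-cong t (1 ℕ.+ 2 ℕ.* a) t≡) (cong suc₄ (fromℕ₄-* 2 a))) ⟩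
  partialSum₄ (cubic₄ A 0₄) (suc₄ (2₄ *₄ A))     ≡⟨ vanishes A ⟩
  0₄                                             ∎
  where
  open ≡-Reasoning
  A = fromℕ₄ a
  period : ∀ A → cubic₄ A 0₄ 0₄ +₄ cubic₄ A 0₄ 1₄ +₄ cubic₄ A 0₄ 2₄ +₄ cubic₄ A 0₄ 3₄ ≡ 0₄
  period = from-yes (∀₄? λ A → cubic₄ A 0₄ 0₄ +₄ cubic₄ A 0₄ 1₄ +₄ cubic₄ A 0₄ 2₄ +₄ cubic₄ A 0₄ 3₄ ≟₄ 0₄)
  vanishes : ∀ A → partialSum₄ (cubic₄ A 0₄) (suc₄ (2₄ *₄ A)) ≡ 0₄
  vanishes = from-yes (∀₄? λ A → partialSum₄ (cubic₄ A 0₄) (suc₄ (2₄ *₄ A)) ≟₄ 0₄)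

quadratic : ℕ → ℤ → ℕ → ℤ
quadratic a n i = + a * n * n + (+ i * + i + + i) * n

quadratic₄ : ℤ₄ → ℤ₄ → ℤ₄ → ℤ₄
quadratic₄ A N I = A *₄ N *₄ N +₄ (I *₄ I +₄ I) *₄ N

mod₄-quadratic : ∀ a n i → mod₄ (quadratic a n i) ≡ quadratic₄ (fromℕ₄ a) (mod₄ n) (fromℕ₄ i)
mod₄-quadratic a n i = trans (mod₄-+ (+ a * n * n) ((+ i * + i + + i) * n))
  (cong₂ _+₄_ (trans (mod₄-* (+ a * n) n) (cong (_*₄ mod₄ n) (mod₄-* (+ a) n)))
              (trans (mod₄-* (+ i * + i + + i) n)
                     (cong (_*₄ mod₄ n) (trans (mod₄-+ (+ i * + i) (+ i)) (cong (_+₄ fromℕ₄ i) (mod₄-* (+ i) (+ i)))))))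

quadratic-step : ∀ a t → t % 4 ≡ (2 ℕ.* a) % 4 →
                 ∀ n i → quadratic a (n + 1ℤ) i ≡₄ quadratic a n i + (pronic (+ i + + t * n) + + a)
quadratic-step a t t≡ = step-by-reduction (quadratic a) (quadratic₄ A) t (+ a) (mod₄-quadratic a) (λ N I →
  trans (law A N I) (cong (λ T → quadratic₄ A N I +₄ (pronic₄ (I +₄ T *₄ N) +₄ A)) T≡))
  where
  A = fromℕ₄ a
  T≡ : 2₄ *₄ A ≡ fromℕ₄ t
  T≡ = trans (sym (fromℕ₄-* 2 a)) (fromℕ₄-cong (2 ℕ.* a) t (sym t≡))
  law : ∀ A N I → quadratic₄ A (N +₄ 1₄) I ≡ quadratic₄ A N I +₄ (pronic₄ (I +₄ 2₄ *₄ A *₄ N) +₄ A)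
  law = from-yes (∀₄? λ A → ∀₄? λ N → ∀₄? λ I →
          quadratic₄ A (N +₄ 1₄) I ≟₄ quadratic₄ A N I +₄ (pronic₄ (I +₄ 2₄ *₄ A *₄ N) +₄ A))

quadratic-sum : ∀ a t → ∑ t (quadratic a 0ℤ) ≡₄ 0ℤ
quadratic-sum a t = cong mod₄ (∑-extend {n = t} ℕ.z≤n (λ i _ → vanishes (+ a) (+ i)))
  where
  vanishes : ∀ a i → a * 0ℤ * 0ℤ + (i * i + i) * 0ℤ ≡ 0ℤ
  vanishes = solve-∀

theorem4 : (t : ℕ) → .{{_ : NonZero t}} → 2 ≤ t → (κ : List ℕ) → IsPartition κ → IsCore t κ →
    (a : ℕ) → a ≤ 1 →
    (t % 4 ≡ (1 Data.Nat.+ 2 Data.Nat.* a) % 4 →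
      (+ 4) ∣ (srank κ - sumTo t (λ i → let x = nvec t κ i + (+ 1 - + 2 * + a) * + i + + a in x * x * x)))
    × (t % 4 ≡ (2 Data.Nat.* a) % 4 →
      (+ 4) ∣ (srank κ - sumTo t (λ i → + a * nvec t κ i * nvec t κ i + (+ i * + i + + i) * nvec t κ i)))
-- The congruences hold for every a and every nonzero t.
theorem4 t _ κ (decreasing , _) core a _ = cubic-case , quadratic-case
  where
  cubic-case : t % 4 ≡ (1 ℕ.+ 2 ℕ.* a) % 4 → + 4 ∣ srank κ - sumTo t (λ i → cubic a (nvec t κ i) i)
  cubic-case t≡ = ≡₄⇒4∣- (srank κ) _
    (srank≡₄∑ t (cubic a) (1ℤ + pronic (+ a)) (cubic-step a t t≡) (cubic-sum a t t≡) κ decreasing core)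
  quadratic-case : t % 4 ≡ (2 ℕ.* a) % 4 → + 4 ∣ srank κ - sumTo t (λ i → quadratic a (nvec t κ i) i)
  quadratic-case t≡ = ≡₄⇒4∣- (srank κ) _
    (srank≡₄∑ t (quadratic a) (+ a) (quadratic-step a t t≡) (quadratic-sum a t) κ decreasing core)
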